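{- For every positive integer $c$ there is a positive integer $f=f(c)$ such that if a graph $G$ contains, as an induced subgraph, (a) a subdivision of the wall $W_{f\times f}$, or (b) the line graph of a subdivision of $W_{f\times f}$, or (c) a proper subdivision of the complete graph $K_f$, then $\operatorname{cl}(G)\ge c$.
   Context: Graphs are finite and simple. $W_{r\times r}$ denotes the $r$-by-$r$ wall (the $r$-by-$r$ hexagonal grid). A subdivision of a graph $H$ is obtained by replacing edges by paths; it is proper if every edge is subdivided at least once. The line graph $L(H)$ has vertex set $E(H)$, two edges adjacent iff they share an end. $\operatorname{cl}(G)$ is the number of distinct lengths of induced cycles of $G$. -}

module Defs where

open import Data.Nat using (ℕ; zero; suc; _+_; _*_; _<_; _≤_; _%_)
open import Data.Nat.Properties using (_<?_)
open import Data.Fin using (Fin; toℕ; fromℕ<)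
open import Data.Product using (Σ; Σ-syntax; _×_; _,_; proj₁; proj₂)
open import Data.Sum using (_⊎_)
open import Relation.Nullary using (¬_; Dec; yes; no)
open import Relation.Binary.PropositionalEquality using (_≡_)

record FinGraph (n : ℕ) : Set₁ where
  field
    Adj     : Fin n → Fin n → Set
    adj-dec : ∀ u v → Dec (Adj u v)
    adj-sym : ∀ {u v} → Adj u v → Adj v u
    adj-irr : ∀ {u} → ¬ Adj u u
open FinGraph public

record Graph : Set₁ where
  field
    V   : Set
    Adj : V → V → Set
open Graph public

InducedIn : Graph → ∀ {n} → FinGraph n → Set
InducedIn H {n} G =
  Σ[ φ ∈ (Graph.V H → Fin n) ]
    ((∀ u v → φ u ≡ φ v → u ≡ v) ×
     (∀ u v → (Graph.Adj H u v → FinGraph.Adj G (φ u) (φ v)) ×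
              (FinGraph.Adj G (φ u) (φ v) → Graph.Adj H u v)))

-- Graphs presented by their edges (each edge listed once, with its two ends).

record EGraph : Set₁ where
  field
    V    : Set
    E    : Set
    ends : E → V × V
open EGraph public

toGraph : EGraph → Graph
toGraph H = record
  { V = EGraph.V H
  ; Adj = λ u v → Σ[ e ∈ EGraph.E H ]
                    ((ends H e ≡ (u , v)) ⊎ (ends H e ≡ (v , u))) }

lineGraph : EGraph → Graph
lineGraph H = record
  { V = EGraph.E H
  ; Adj = λ a b → ¬ a ≡ b ×
      ((proj₁ (ends H a) ≡ proj₁ (ends H b)) ⊎ (proj₁ (ends H a) ≡ proj₂ (ends H b)) ⊎
       (proj₂ (ends H a) ≡ proj₁ (ends H b)) ⊎ (proj₂ (ends H a) ≡ proj₂ (ends H b))) }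

fromRel : (V : Set) → (V → V → Set) → EGraph
fromRel V R = record { V = V ; E = Σ[ p ∈ V × V ] R (proj₁ p) (proj₂ p) ; ends = proj₁ }

-- Subdivision: edge e is replaced by a path with ℓ e new internal vertices
-- (ℓ e = 0 means e is not subdivided).

module _ (H : EGraph) (ℓ : EGraph.E H → ℕ) where

  SubV : Set
  SubV = EGraph.V H ⊎ Σ[ e ∈ EGraph.E H ] Fin (ℓ e)

  -- k-th vertex (k = 0 … ℓ e + 1) along the path replacing e
  pathVertex : (e : EGraph.E H) → ℕ → SubV
  pathVertex e zero = _⊎_.inj₁ (proj₁ (ends H e))
  pathVertex e (suc k) with k <? ℓ e
  ... | yes p = _⊎_.inj₂ (e , fromℕ< p)
  ... | no _  = _⊎_.inj₁ (proj₂ (ends H e))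

  subdivide : EGraph
  subdivide = record
    { V = SubV
    ; E = Σ[ e ∈ EGraph.E H ] Fin (suc (ℓ e))
    ; ends = λ { (e , k) → (pathVertex e (toℕ k) , pathVertex e (suc (toℕ k))) } }

Proper : (H : EGraph) → (EGraph.E H → ℕ) → Set
Proper H ℓ = ∀ e → 1 ≤ ℓ e

-- The r-by-r wall: vertices (i , j) with i < r (rows), j < 2r (columns);
-- horizontal edges (i , j)(i , j+1); vertical edges (i , j)(i+1 , j) when i + j is even.

WallRel : (r : ℕ) → (Fin r × Fin (2 * r)) → (Fin r × Fin (2 * r)) → Set
WallRel r (i , j) (i' , j') =
  (i ≡ i' × suc (toℕ j) ≡ toℕ j') ⊎
  (j ≡ j' × suc (toℕ i) ≡ toℕ i' × (toℕ i + toℕ j) % 2 ≡ 0)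

wall : ℕ → EGraph
wall r = fromRel (Fin r × Fin (2 * r)) (WallRel r)

complete : ℕ → EGraph
complete f = fromRel (Fin f) (λ i j → toℕ i < toℕ j)

cycleGraph : ℕ → Graph
cycleGraph k = record
  { V = Fin k
  ; Adj = λ i j → Consec i j ⊎ Consec j i }
  where
  Consec : Fin k → Fin k → Set
  Consec i j = (suc (toℕ i) ≡ toℕ j) ⊎ ((suc (toℕ i) ≡ k) × (toℕ j ≡ 0))

HasInducedCycle : ∀ {n} → FinGraph n → ℕ → Set
HasInducedCycle G k = (3 ≤ k) × InducedIn (cycleGraph k) G

-- cl(G) ≥ c : G has induced cycles of at least c distinct lengths
ClAtLeast : ∀ {n} → FinGraph n → ℕ → Set
ClAtLeast G c =
  Σ[ len ∈ (Fin c → ℕ) ]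
    ((∀ a b → len a ≡ len b → a ≡ b) × (∀ a → HasInducedCycle G (len a)))

-- For 0 ≤ a < b ≤ N = (c − 1)² + 2 the graph G contains an induced cycle of length
-- len a b = S b − S a + ρ a + ρ b, where S is strictly increasing.  A cycle of H stays induced
-- after subdivision when its unsubdivided chords are cycle edges, and then has length
-- Σ (ℓ e + 1) over its edges; the edges of any cycle form an induced cycle of the line graph.
-- For the wall take the boundary of the three-row ladder on columns 4a … 4b + 1 (it is induced
-- in the wall); for K_f take the cycle 0, a + 1, a + 2, …, b + 1 (every chord is subdivided).
-- Since len b N + 2 S b = const + len 0 b, the (c − 1)² + 1 pairs (len 0 b , len b N), 0 < b < N,
-- are pairwise distinct, so their coordinates take at least c distinct values.

module Submission where

open import Defs
open import Data.Nat using (ℕ; zero; suc; pred; _+_; _*_; _∸_; _<_; _≤_; z≤n; s≤s; _%_; _≟_; _<?_; _≤?_)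
open import Data.Nat.Properties
open import Data.Nat.DivMod using (_mod_; m<n⇒m%n≡m; %-distribˡ-+; [m+n]%n≡m%n; m%n%n≡m%n; m*n%n≡0)
open import Data.Nat.Tactic.RingSolver using (solve-∀)
open import Data.Fin as Fin using (Fin; toℕ; fromℕ<; inject≤; combine)
open import Data.Fin.Properties
  using (toℕ-injective; toℕ<n; toℕ-fromℕ<; inject≤-injective; combine-injective; injective⇒≤)
open import Data.List using (List; length; lookup; tabulate; deduplicate; _++_)
open import Data.List.Membership.Propositional using (_∈_)
open import Data.List.Membership.Propositional.Properties
  using (∈-lookup; ∈-tabulate⁺; ∈-tabulate⁻; ∈-++⁺ˡ; ∈-++⁺ʳ; ∈-++⁻; ∈-deduplicate⁺; ∈-deduplicate⁻)
open import Data.List.Membership.Setoid.Properties using (index-injective)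
import Data.List.Relation.Unary.Any as Any
import Data.List.Relation.Unary.All as All
open import Data.List.Relation.Unary.Unique.Propositional using (Unique; _∷_)
open import Data.List.Relation.Unary.Unique.DecPropositional.Properties using (deduplicate-!)
open import Data.Bool using (Bool; true; false; if_then_else_)
open import Data.Product using (Σ-syntax; _×_; _,_; proj₁; proj₂)
open import Data.Sum as Sum using (_⊎_; inj₁; inj₂)
open import Data.Empty using (⊥; ⊥-elim)
open import Function using (_∘_)
open import Relation.Nullary using (¬_; Dec; yes; no)
open import Relation.Nullary.Decidable using (_×-dec_; _⊎-dec_)
open import Relation.Binary using (Decidable; tri<; tri≈; tri>)
open import Relation.Binary.PropositionalEquality
open import Axiom.UniquenessOfIdentityProofs.WithK using (uip)

Distinct : (ℕ → Set) → ℕ → Set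
Distinct P c = Σ[ len ∈ (Fin c → ℕ) ] ((∀ a b → len a ≡ len b → a ≡ b) × (∀ a → P (len a)))

Unique⇒lookup-injective : ∀ {A : Set} {xs : List A} → Unique xs → ∀ i j → lookup xs i ≡ lookup xs j → i ≡ j
Unique⇒lookup-injective (_ ∷ _)     Fin.zero    Fin.zero    _  = refl
Unique⇒lookup-injective (x∉xs ∷ _)  Fin.zero    (Fin.suc j) eq = ⊥-elim (All.lookup x∉xs (∈-lookup j) eq)
Unique⇒lookup-injective (x∉xs ∷ _)  (Fin.suc i) Fin.zero    eq = ⊥-elim (All.lookup x∉xs (∈-lookup i) (sym eq))
Unique⇒lookup-injective (_ ∷ !xs)   (Fin.suc i) (Fin.suc j) eq = cong Fin.suc (Unique⇒lookup-injective !xs i j eq)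

distinct-from-unique : ∀ {P c} (vs : List ℕ) → Unique vs → (∀ {z} → z ∈ vs → P z) → c ≤ length vs → Distinct P c
distinct-from-unique vs !vs P-vs c≤|vs| =
  (λ a → lookup vs (inject≤ a c≤|vs|)) ,
  (λ a b eq → inject≤-injective c≤|vs| c≤|vs| a b (Unique⇒lookup-injective !vs _ _ eq)) ,
  (λ a → P-vs (∈-lookup _))

-- The K pairs (x b , y b) are distinct elements of vs × vs, where vs lists the values taken.
distinct-from-pairs : ∀ {P : ℕ → Set} c {K} (x y : Fin K → ℕ) →
  (∀ b → P (x b)) → (∀ b → P (y b)) → (∀ b b′ → x b ≡ x b′ → y b ≡ y b′ → b ≡ b′) →
  c * c < K → Distinct P (suc c)
distinct-from-pairs {P} c {K} x y P-x P-y pair-injective c²<K = decide (suc c ≤? length vs)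
  where
  values = tabulate x ++ tabulate y
  vs = deduplicate _≟_ values

  P-vs : ∀ {z} → z ∈ vs → P z
  P-vs z∈vs with ∈-++⁻ (tabulate x) (∈-deduplicate⁻ _≟_ values z∈vs)
  ... | inj₁ z∈x = subst P (sym (proj₂ (∈-tabulate⁻ z∈x))) (P-x _)
  ... | inj₂ z∈y = subst P (sym (proj₂ (∈-tabulate⁻ z∈y))) (P-y _)

  x∈vs : ∀ b → x b ∈ vs
  x∈vs b = ∈-deduplicate⁺ _≟_ (∈-++⁺ˡ (∈-tabulate⁺ b))
  y∈vs : ∀ b → y b ∈ vs
  y∈vs b = ∈-deduplicate⁺ _≟_ (∈-++⁺ʳ (tabulate x) (∈-tabulate⁺ b))

  code : Fin K → Fin (length vs * length vs)
  code b = combine (Any.index (x∈vs b)) (Any.index (y∈vs b))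
  code-injective : ∀ {b b′} → code b ≡ code b′ → b ≡ b′
  code-injective {b} {b′} eq with combine-injective (Any.index (x∈vs b)) _ (Any.index (x∈vs b′)) _ eq
  ... | ix≡ , iy≡ = pair-injective b b′ (index-injective (setoid ℕ) (x∈vs b) (x∈vs b′) ix≡)
                                         (index-injective (setoid ℕ) (y∈vs b) (y∈vs b′) iy≡)

  decide : Dec (suc c ≤ length vs) → Distinct P (suc c)
  decide (yes c<|vs|) = distinct-from-unique vs (deduplicate-! _≟_ values) P-vs c<|vs|
  decide (no |vs|≰c)  = ⊥-elim (<⇒≱ c²<K (≤-trans (injective⇒≤ code-injective) (*-mono-≤ |vs|≤c |vs|≤c)))
    where
    |vs|≤c : length vs ≤ c
    |vs|≤c = ≤-pred (≰⇒> |vs|≰c)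

distinct-from-potential : ∀ {P : ℕ → Set} c (len : ℕ → ℕ → ℕ) (S ρ : ℕ → ℕ) →
  (∀ x y → x ≤ 2 + c * c → y ≤ 2 + c * c → S x ≡ S y → x ≡ y) →
  (∀ a b → a < b → b ≤ 2 + c * c → len a b + S a ≡ S b + ρ a + ρ b) →
  (∀ a b → a < b → b ≤ 2 + c * c → P (len a b)) →
  Distinct P (suc c)
distinct-from-potential {P} c len S ρ S-injective len-potential P-len =
  distinct-from-pairs {P} c (λ b → len 0 (β b)) (λ b → len (β b) N)
    (λ b → P-len 0 (β b) (s≤s z≤n) (m≤n⇒m≤1+n (β≤K b)))
    (λ b → P-len (β b) N (s≤s (β≤K b)) ≤-refl)
    pair-injective ≤-refl
  where
  K = suc (c * c)
  N = suc K
  β : Fin K → ℕ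
  β b = suc (toℕ b)
  β≤K : ∀ b → β b ≤ K
  β≤K b = toℕ<n b

  balance : ∀ b → len (β b) N + 2 * S (β b) + ρ 0 ≡ S N + ρ N + (len 0 (β b) + S 0)
  balance b = begin
    len B N + 2 * S B + ρ 0        ≡⟨ regroup₁ (len B N) (S B) (ρ 0) ⟩
    (len B N + S B) + (S B + ρ 0)  ≡⟨ cong (_+ (S B + ρ 0)) (len-potential B N (s≤s (β≤K b)) ≤-refl) ⟩
    (S N + ρ B + ρ N) + (S B + ρ 0) ≡⟨ regroup₂ (S N) (ρ B) (ρ N) (S B) (ρ 0) ⟩
    (S N + ρ N) + (S B + ρ 0 + ρ B) ≡⟨ cong ((S N + ρ N) +_)
                                          (sym (len-potential 0 B (s≤s z≤n) (m≤n⇒m≤1+n (β≤K b)))) ⟩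
    (S N + ρ N) + (len 0 B + S 0)  ∎
    where
    open ≡-Reasoning
    B = β b
    regroup₁ : ∀ x s r → x + 2 * s + r ≡ (x + s) + (s + r)
    regroup₁ = solve-∀
    regroup₂ : ∀ s p q t r → (s + p + q) + (t + r) ≡ (s + q) + (t + r + p)
    regroup₂ = solve-∀

  pair-injective : ∀ b b′ → len 0 (β b) ≡ len 0 (β b′) → len (β b) N ≡ len (β b′) N → b ≡ b′
  pair-injective b b′ x≡ y≡ =
    toℕ-injective (suc-injective (S-injective (β b) (β b′) (m≤n⇒m≤1+n (β≤K b)) (m≤n⇒m≤1+n (β≤K b′)) S≡))
    where
    S≡ : S (β b) ≡ S (β b′)
    S≡ = *-cancelˡ-≡ (S (β b)) (S (β b′)) 2 (+-cancelˡ-≡ (len (β b) N) _ _ (+-cancelʳ-≡ (ρ 0) _ _ (begin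
      len (β b) N + 2 * S (β b) + ρ 0 ≡⟨ balance b ⟩
      S N + ρ N + (len 0 (β b) + S 0) ≡⟨ cong (λ z → S N + ρ N + (z + S 0)) x≡ ⟩
      S N + ρ N + (len 0 (β b′) + S 0) ≡⟨ sym (balance b′) ⟩
      len (β b′) N + 2 * S (β b′) + ρ 0 ≡⟨ cong (λ z → z + 2 * S (β b′) + ρ 0) (sym y≡) ⟩
      len (β b) N + 2 * S (β b′) + ρ 0 ∎)))
      where open ≡-Reasoning

sucMod : ℕ → ℕ → ℕ
sucMod M t with suc t <? M
... | yes _ = suc t
... | no _  = 0

sucMod-cases : ∀ {M} t → t < M → (suc t < M × sucMod M t ≡ suc t) ⊎ (suc t ≡ M × sucMod M t ≡ 0)
sucMod-cases {M} t t<M with suc t <? M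
... | yes t+1<M = inj₁ (t+1<M , refl)
... | no  t+1≮M = inj₂ (≤-antisym t<M (≮⇒≥ t+1≮M) , refl)

sucMod-< : ∀ {M t} → suc t < M → sucMod M t ≡ suc t
sucMod-< {M} {t} t+1<M with suc t <? M
... | yes _      = refl
... | no t+1≮M   = ⊥-elim (t+1≮M t+1<M)

sucMod-≡ : ∀ {M t} → suc t ≡ M → sucMod M t ≡ 0
sucMod-≡ {M} {t} t+1≡M with suc t <? M
... | yes t+1<M = ⊥-elim (<-irrefl t+1≡M t+1<M)
... | no _      = refl

sucMod<M : ∀ {M} t → 0 < M → sucMod M t < M
sucMod<M {M} t 0<M with suc t <? M
... | yes t+1<M = t+1<M
... | no _      = 0<M

sucMod-injective : ∀ {M s t} → s < M → t < M → sucMod M s ≡ sucMod M t → s ≡ t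
sucMod-injective {s = s} {t} s<M t<M eq with sucMod-cases s s<M | sucMod-cases t t<M
... | inj₁ (_ , s′) | inj₁ (_ , t′) = suc-injective (trans (sym s′) (trans eq t′))
... | inj₁ (_ , s′) | inj₂ (_ , t′) = ⊥-elim (1+n≢0 (trans (sym s′) (trans eq t′)))
... | inj₂ (_ , s′) | inj₁ (_ , t′) = ⊥-elim (1+n≢0 (trans (sym t′) (trans (sym eq) s′)))
... | inj₂ (s+1≡M , _) | inj₂ (t+1≡M , _) = suc-injective (trans s+1≡M (sym t+1≡M))

sucMod-≢ : ∀ {M t} → 2 ≤ M → t < M → sucMod M t ≢ t
sucMod-≢ {t = t} 2≤M t<M eq with sucMod-cases t t<M
... | inj₁ (_ , t′)      = 1+n≢n (trans (sym t′) eq)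
... | inj₂ (t+1≡M , t′)  = <-irrefl (trans (cong suc (trans (sym t′) eq)) t+1≡M) 2≤M

sucMod²-≢ : ∀ {M t} → 3 ≤ M → t < M → sucMod M (sucMod M t) ≢ t
sucMod²-≢ {M} {t} 3≤M t<M eq with sucMod-cases t t<M
... | inj₂ (t+1≡M , t′) = <-irrefl (trans (cong suc 1≡t) t+1≡M) 3≤M
  where
  1≡t : 1 ≡ t
  1≡t = trans (sym (sucMod-< (≤-trans (s≤s (s≤s z≤n)) 3≤M))) (subst (λ z → sucMod M z ≡ t) t′ eq)
... | inj₁ (t+1<M , t′) with sucMod-cases (suc t) t+1<M | subst (λ z → sucMod M z ≡ t) t′ eq
...   | inj₁ (_ , t″)       | eq′ = <-irrefl (sym (trans (sym t″) eq′)) (m<n⇒m<1+n (n<1+n t))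
...   | inj₂ (t+2≡M , t″)   | eq′ = <-irrefl (trans (cong (λ z → suc (suc z)) (trans (sym t″) eq′)) t+2≡M) 3≤M

sumBelow : (ℕ → ℕ) → ℕ → ℕ
sumBelow w zero    = 0
sumBelow w (suc n) = sumBelow w n + w n

sumBelow-cong : ∀ {f g} n → (∀ i → i < n → f i ≡ g i) → sumBelow f n ≡ sumBelow g n
sumBelow-cong zero    f≡g = refl
sumBelow-cong (suc n) f≡g = cong₂ _+_ (sumBelow-cong n (λ i i<n → f≡g i (m<n⇒m<1+n i<n))) (f≡g n ≤-refl)

sumBelow-+ : ∀ f g n → sumBelow (λ i → f i + g i) n ≡ sumBelow f n + sumBelow g n
sumBelow-+ f g zero    = refl
sumBelow-+ f g (suc n) =
  trans (cong (_+ (f n + g n)) (sumBelow-+ f g n)) (regroup (sumBelow f n) (sumBelow g n) (f n) (g n))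
  where
  regroup : ∀ a b c d → (a + b) + (c + d) ≡ (a + c) + (b + d)
  regroup = solve-∀

sumBelow-split : ∀ f n a → sumBelow f (n + a) ≡ sumBelow f a + sumBelow (λ i → f (i + a)) n
sumBelow-split f zero    a = sym (+-identityʳ _)
sumBelow-split f (suc n) a = trans (cong (_+ f (n + a)) (sumBelow-split f n a)) (+-assoc (sumBelow f a) _ _)

sumBelow-shift : ∀ f n → sumBelow f (suc n) ≡ f 0 + sumBelow (λ i → f (suc i)) n
sumBelow-shift f zero    = sym (+-identityʳ (f 0))
sumBelow-shift f (suc n) = trans (cong (_+ f (suc n)) (sumBelow-shift f n)) (+-assoc (f 0) _ _)

sumBelow-reverse : ∀ f n → sumBelow (λ i → f (n ∸ suc i)) n ≡ sumBelow f n
sumBelow-reverse f zero    = refl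
sumBelow-reverse f (suc n) = begin
  sumBelow (λ i → f (n ∸ i)) n + f (n ∸ n)     ≡⟨ cong₂ _+_ (sumBelow-cong n (λ i i<n → cong f (+-∸-assoc 1 i<n)))
                                                           (cong f (n∸n≡0 n)) ⟩
  sumBelow (λ i → f (suc (n ∸ suc i))) n + f 0 ≡⟨ cong (_+ f 0) (sumBelow-reverse (λ i → f (suc i)) n) ⟩
  sumBelow (λ i → f (suc i)) n + f 0           ≡⟨ +-comm _ (f 0) ⟩
  f 0 + sumBelow (λ i → f (suc i)) n           ≡⟨ sym (sumBelow-shift f n) ⟩
  sumBelow f (suc n)                           ∎
  where open ≡-Reasoning

sumBelow-monoʳ-≤ : ∀ w {i j} → i ≤ j → sumBelow w i ≤ sumBelow w j
sumBelow-monoʳ-≤ w {i} {j} i≤j = begin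
  sumBelow w i                                       ≤⟨ m≤m+n _ _ ⟩
  sumBelow w i + sumBelow (λ k → w (k + i)) (j ∸ i)  ≡⟨ sym (sumBelow-split w (j ∸ i) i) ⟩
  sumBelow w (j ∸ i + i)                             ≡⟨ cong (sumBelow w) (m∸n+n≡m i≤j) ⟩
  sumBelow w j                                       ∎
  where open ≤-Reasoning

module _ {w : ℕ → ℕ} (w-positive : ∀ i → 1 ≤ w i) where

  sumBelow-strictMonoʳ : ∀ {i j} → i < j → sumBelow w i < sumBelow w j
  sumBelow-strictMonoʳ {i} {suc j} (s≤s i≤j) =
    ≤-trans (s≤s (sumBelow-monoʳ-≤ w i≤j)) (≤-trans (≤-reflexive (+-comm 1 _)) (+-monoʳ-≤ _ (w-positive j)))

  sumBelow-injective : ∀ {i j} → sumBelow w i ≡ sumBelow w j → i ≡ j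
  sumBelow-injective {i} {j} eq with <-cmp i j
  ... | tri< i<j _ _ = ⊥-elim (<-irrefl eq (sumBelow-strictMonoʳ i<j))
  ... | tri≈ _ i≡j _ = i≡j
  ... | tri> _ _ j<i = ⊥-elim (<-irrefl (sym eq) (sumBelow-strictMonoʳ j<i))

  sumBelow-≥ : ∀ n → n ≤ sumBelow w n
  sumBelow-≥ zero    = z≤n
  sumBelow-≥ (suc n) = ≤-trans (≤-reflexive (+-comm 1 n)) (+-mono-≤ (sumBelow-≥ n) (w-positive n))

locate : (ℕ → ℕ) → ℕ → ℕ → ℕ × ℕ
locate w zero    t = (0 , t)
locate w (suc m) t with t <? sumBelow w m
... | yes _ = locate w m t
... | no _  = (m , t ∸ sumBelow w m)

locate-sumBelow : ∀ w {m i k} → i < m → k < w i → locate w m (sumBelow w i + k) ≡ (i , k)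
locate-sumBelow w {suc m} {i} {k} (s≤s i≤m) k<w with sumBelow w i + k <? sumBelow w m | m≤n⇒m<n∨m≡n i≤m
... | yes _       | inj₁ i<m  = locate-sumBelow w i<m k<w
... | yes t<Σm    | inj₂ refl = ⊥-elim (<⇒≱ t<Σm (m≤m+n _ k))
... | no  _       | inj₂ refl = cong (i ,_) (m+n∸m≡n (sumBelow w i) k)
... | no  t≮Σm    | inj₁ i<m  =
      ⊥-elim (t≮Σm (≤-trans (+-monoʳ-< (sumBelow w i) k<w) (sumBelow-monoʳ-≤ w i<m)))

locate-valid : ∀ w {m t} → t < sumBelow w m →
  let (i , k) = locate w m t in i < m × k < w i × sumBelow w i + k ≡ t
locate-valid w {suc m} {t} t<Σ with t <? sumBelow w m
... | yes t<Σm with locate-valid w t<Σm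
...   | i<m , k<w , eq = m<n⇒m<1+n i<m , k<w , eq
locate-valid w {suc m} {t} t<Σ | no t≮Σm =
  ≤-refl , +-cancelˡ-< (sumBelow w m) _ _ (subst (_< sumBelow w m + w m) (sym (m+[n∸m]≡n (≮⇒≥ t≮Σm))) t<Σ) ,
  m+[n∸m]≡n (≮⇒≥ t≮Σm)

toℕ-mod : ∀ {k n} → k < suc n → toℕ (k mod suc n) ≡ k
toℕ-mod k<n = trans (toℕ-fromℕ< _) (m<n⇒m%n≡m k<n)

infix 4 _↪_

_↪_ : Graph → Graph → Set
A ↪ B = Σ[ ψ ∈ (Graph.V A → Graph.V B) ]
  ((∀ x y → ψ x ≡ ψ y → x ≡ y) ×
   (∀ x y → (Graph.Adj A x y → Graph.Adj B (ψ x) (ψ y)) × (Graph.Adj B (ψ x) (ψ y) → Graph.Adj A x y)))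

↪-inducedIn : ∀ {A B n} (G : FinGraph n) → A ↪ B → InducedIn B G → InducedIn A G
↪-inducedIn G (ψ , ψ-injective , ψ-adj) (φ , φ-injective , φ-adj) =
  (λ x → φ (ψ x)) ,
  (λ x y eq → ψ-injective x y (φ-injective (ψ x) (ψ y) eq)) ,
  (λ x y → (λ a → proj₁ (φ-adj (ψ x) (ψ y)) (proj₁ (ψ-adj x y) a)) ,
           (λ a → proj₂ (ψ-adj x y) (proj₂ (φ-adj (ψ x) (ψ y)) a)))

cycle↪ : ∀ (Γ : Graph) {W} (p : ℕ → Graph.V Γ) →
  (∀ {x y} → Graph.Adj Γ x y → Graph.Adj Γ y x) →
  (∀ s t → s < W → t < W → p s ≡ p t → s ≡ t) →
  (∀ t → t < W → Graph.Adj Γ (p t) (p (sucMod W t))) →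
  (∀ s t → s < W → t < W → Graph.Adj Γ (p s) (p t) → t ≡ sucMod W s ⊎ s ≡ sucMod W t) →
  cycleGraph W ↪ Γ
cycle↪ Γ {W} p adj-sym p-injective p-step p-steps-only =
  (λ i → p (toℕ i)) ,
  (λ i j eq → toℕ-injective (p-injective _ _ (toℕ<n i) (toℕ<n j) eq)) ,
  (λ i j → forth i j , back i j)
  where
  Consecutive : Fin W → Fin W → Set
  Consecutive i j = (suc (toℕ i) ≡ toℕ j) ⊎ ((suc (toℕ i) ≡ W) × (toℕ j ≡ 0))

  consecutive⇒sucMod : ∀ i j → Consecutive i j → toℕ j ≡ sucMod W (toℕ i)
  consecutive⇒sucMod i j (inj₁ i+1≡j)        = sym (trans (sucMod-< (subst (_< W) (sym i+1≡j) (toℕ<n j))) i+1≡j)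
  consecutive⇒sucMod i j (inj₂ (i+1≡W , j≡0)) = trans j≡0 (sym (sucMod-≡ i+1≡W))

  sucMod⇒consecutive : ∀ i j → toℕ j ≡ sucMod W (toℕ i) → Consecutive i j
  sucMod⇒consecutive i j j≡ with sucMod-cases (toℕ i) (toℕ<n i)
  ... | inj₁ (_ , i′)      = inj₁ (sym (trans j≡ i′))
  ... | inj₂ (i+1≡W , i′)  = inj₂ (i+1≡W , trans j≡ i′)

  forth : ∀ i j → Graph.Adj (cycleGraph W) i j → Graph.Adj Γ (p (toℕ i)) (p (toℕ j))
  forth i j (inj₁ c) =
    subst (λ t → Graph.Adj Γ (p (toℕ i)) (p t)) (sym (consecutive⇒sucMod i j c)) (p-step _ (toℕ<n i))
  forth i j (inj₂ c) =
    adj-sym (subst (λ t → Graph.Adj Γ (p (toℕ j)) (p t)) (sym (consecutive⇒sucMod j i c)) (p-step _ (toℕ<n j)))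

  back : ∀ i j → Graph.Adj Γ (p (toℕ i)) (p (toℕ j)) → Graph.Adj (cycleGraph W) i j
  back i j a with p-steps-only _ _ (toℕ<n i) (toℕ<n j) a
  ... | inj₁ j≡ = inj₁ (sucMod⇒consecutive i j j≡)
  ... | inj₂ i≡ = inj₂ (sucMod⇒consecutive j i i≡)

module _ (K : EGraph) where

  IsEnd : EGraph.V K → EGraph.E K → Set
  IsEnd x a = (proj₁ (EGraph.ends K a) ≡ x) ⊎ (proj₂ (EGraph.ends K a) ≡ x)

  Joins : EGraph.E K → EGraph.V K → EGraph.V K → Set
  Joins a x y = (EGraph.ends K a ≡ (x , y)) ⊎ (EGraph.ends K a ≡ (y , x))

  joins-isEnd₁ : ∀ {a x y} → Joins a x y → IsEnd x a
  joins-isEnd₁ (inj₁ refl) = inj₁ refl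
  joins-isEnd₁ (inj₂ refl) = inj₂ refl

  joins-isEnd₂ : ∀ {a x y} → Joins a x y → IsEnd y a
  joins-isEnd₂ (inj₁ refl) = inj₂ refl
  joins-isEnd₂ (inj₂ refl) = inj₁ refl

  isEnd-joins : ∀ {a x y z} → Joins a x y → IsEnd z a → z ≡ x ⊎ z ≡ y
  isEnd-joins (inj₁ refl) (inj₁ refl) = inj₁ refl
  isEnd-joins (inj₁ refl) (inj₂ refl) = inj₂ refl
  isEnd-joins (inj₂ refl) (inj₁ refl) = inj₂ refl
  isEnd-joins (inj₂ refl) (inj₂ refl) = inj₁ refl

  toGraph-sym : ∀ {x y} → Graph.Adj (toGraph K) x y → Graph.Adj (toGraph K) y x
  toGraph-sym (a , inj₁ eq) = a , inj₂ eq
  toGraph-sym (a , inj₂ eq) = a , inj₁ eq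

  lineGraph-adj : ∀ {a b x} → a ≢ b → IsEnd x a → IsEnd x b → Graph.Adj (lineGraph K) a b
  lineGraph-adj a≢b (inj₁ p) (inj₁ q) = a≢b , inj₁ (trans p (sym q))
  lineGraph-adj a≢b (inj₁ p) (inj₂ q) = a≢b , inj₂ (inj₁ (trans p (sym q)))
  lineGraph-adj a≢b (inj₂ p) (inj₁ q) = a≢b , inj₂ (inj₂ (inj₁ (trans p (sym q))))
  lineGraph-adj a≢b (inj₂ p) (inj₂ q) = a≢b , inj₂ (inj₂ (inj₂ (trans p (sym q))))

  lineGraph-common : ∀ {a b} → Graph.Adj (lineGraph K) a b → Σ[ x ∈ EGraph.V K ] (IsEnd x a × IsEnd x b)
  lineGraph-common (_ , inj₁ p)                = _ , inj₁ refl , inj₁ (sym p)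
  lineGraph-common (_ , inj₂ (inj₁ p))         = _ , inj₁ refl , inj₂ (sym p)
  lineGraph-common (_ , inj₂ (inj₂ (inj₁ p)))  = _ , inj₂ refl , inj₁ (sym p)
  lineGraph-common (_ , inj₂ (inj₂ (inj₂ p)))  = _ , inj₂ refl , inj₂ (sym p)

  lineGraph-sym : ∀ {a b} → Graph.Adj (lineGraph K) a b → Graph.Adj (lineGraph K) b a
  lineGraph-sym adj@(a≢b , _) with lineGraph-common adj
  ... | _ , x∈a , x∈b = lineGraph-adj (λ b≡a → a≢b (sym b≡a)) x∈b x∈a

module _ (H : EGraph) (ℓ : EGraph.E H → ℕ) where

  pathVertex-inner : ∀ d {r} (r<ℓ : r < ℓ d) → pathVertex H ℓ d (suc r) ≡ inj₂ (d , fromℕ< r<ℓ)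
  pathVertex-inner d {r} r<ℓ with r <? ℓ d
  ... | yes _   = refl
  ... | no r≮ℓ  = ⊥-elim (r≮ℓ r<ℓ)

  pathVertex-last : ∀ d {r} → ℓ d ≤ r → pathVertex H ℓ d (suc r) ≡ inj₁ (proj₂ (EGraph.ends H d))
  pathVertex-last d {r} ℓ≤r with r <? ℓ d
  ... | yes r<ℓ = ⊥-elim (<⇒≱ r<ℓ ℓ≤r)
  ... | no _    = refl

record Cycle (H : EGraph) (m : ℕ) : Set where
  field
    length≥3         : 3 ≤ m
    vertex           : ℕ → EGraph.V H
    edge             : ℕ → EGraph.E H
    forward          : ℕ → Bool
    edge-ends        : ∀ i → i < m → EGraph.ends H (edge i) ≡
                         (if forward i then (vertex i , vertex (sucMod m i)) else (vertex (sucMod m i) , vertex i))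
    vertex-injective : ∀ i j → i < m → j < m → vertex i ≡ vertex j → i ≡ j

subdividedLength : ∀ {H m} → (EGraph.E H → ℕ) → Cycle H m → ℕ
subdividedLength {m = m} ℓ C = sumBelow (λ i → suc (ℓ (Cycle.edge C i))) m

ChordsSubdivided : ∀ {H m} → (EGraph.E H → ℕ) → Cycle H m → Set
ChordsSubdivided {H} {m} ℓ C =
  ∀ d i j → i < m → j < m → EGraph.ends H d ≡ (Cycle.vertex C i , Cycle.vertex C j) → ℓ d ≡ 0 →
  Σ[ k ∈ ℕ ] (k < m × d ≡ Cycle.edge C k)

-- Position (i , k) is the k-th vertex on the path replacing edge i, walking from vertex i.
module SubdividedCycle {H : EGraph} (ℓ : EGraph.E H → ℕ) {m : ℕ} (C : Cycle H m) where
  open Cycle C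

  Hℓ : EGraph
  Hℓ = subdivide H ℓ

  w : ℕ → ℕ
  w i = suc (ℓ (edge i))

  W : ℕ
  W = subdividedLength ℓ C

  Position : Set
  Position = ℕ × ℕ

  Valid : Position → Set
  Valid (i , k) = i < m × k < w i

  vertexAt : Position → SubV H ℓ
  vertexAt (i , k) with forward i
  ... | true  = pathVertex H ℓ (edge i) k
  ... | false = pathVertex H ℓ (edge i) (w i ∸ k)

  vertexAt-start : ∀ {i} → i < m → vertexAt (i , 0) ≡ inj₁ (vertex i)
  vertexAt-start {i} i<m with forward i | edge-ends i i<m
  ... | true  | ends≡ = cong (λ e → inj₁ (proj₁ e)) ends≡
  ... | false | ends≡ = trans (pathVertex-last H ℓ (edge i) ≤-refl) (cong (λ e → inj₁ (proj₂ e)) ends≡)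

  vertexAt-end : ∀ {i} → i < m → vertexAt (i , w i) ≡ inj₁ (vertex (sucMod m i))
  vertexAt-end {i} i<m with forward i | edge-ends i i<m
  ... | true  | ends≡ = trans (pathVertex-last H ℓ (edge i) ≤-refl) (cong (λ e → inj₁ (proj₂ e)) ends≡)
  ... | false | ends≡ = trans (cong (pathVertex H ℓ (edge i)) (n∸n≡0 (w i))) (cong (λ e → inj₁ (proj₁ e)) ends≡)

  innerIndex : Bool → ℕ → ℕ → ℕ
  innerIndex true  L k = pred k
  innerIndex false L k = L ∸ k

  innerIndex-injective : ∀ b L {k k′} → 1 ≤ k → k ≤ L → 1 ≤ k′ → k′ ≤ L →
                         innerIndex b L k ≡ innerIndex b L k′ → k ≡ k′
  innerIndex-injective true  L {suc k} {suc k′} _ _ _ _ eq = cong suc eq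
  innerIndex-injective false L _ k≤L _ k′≤L eq = ∸-cancelˡ-≡ k≤L k′≤L eq

  vertexAt-inner : ∀ {i k} → 1 ≤ k → k < w i →
    Σ[ x ∈ Fin (ℓ (edge i)) ] (vertexAt (i , k) ≡ inj₂ (edge i , x) × toℕ x ≡ innerIndex (forward i) (ℓ (edge i)) k)
  vertexAt-inner {i} {suc k} _ (s≤s k<ℓ) with forward i
  ... | true  = fromℕ< k<ℓ , pathVertex-inner H ℓ (edge i) k<ℓ , toℕ-fromℕ< k<ℓ
  ... | false = fromℕ< r<ℓ ,
                trans (cong (pathVertex H ℓ (edge i)) (+-∸-assoc 1 k<ℓ)) (pathVertex-inner H ℓ (edge i) r<ℓ) ,
                toℕ-fromℕ< r<ℓ
    where
    r<ℓ : ℓ (edge i) ∸ suc k < ℓ (edge i)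
    r<ℓ = ∸-monoʳ-< {ℓ (edge i)} {suc k} {0} (s≤s z≤n) k<ℓ

  private
    inj₁-injective : ∀ {x y : EGraph.V H} → _≡_ {A = SubV H ℓ} (inj₁ x) (inj₁ y) → x ≡ y
    inj₁-injective refl = refl

    inj₂-edge : ∀ {a b : EGraph.E H} {x : Fin (ℓ a)} {y : Fin (ℓ b)} →
                _≡_ {A = SubV H ℓ} (inj₂ (a , x)) (inj₂ (b , y)) → a ≡ b
    inj₂-edge refl = refl

    inj₂-index : ∀ {a : EGraph.E H} {x y : Fin (ℓ a)} →
                 _≡_ {A = SubV H ℓ} (inj₂ (a , x)) (inj₂ (a , y)) → toℕ x ≡ toℕ y
    inj₂-index refl = refl

  vertexAt-branch : ∀ {i k v} → Valid (i , k) → vertexAt (i , k) ≡ inj₁ v → v ≡ vertex i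
  vertexAt-branch {k = zero}  (i<m , _) eq = inj₁-injective (trans (sym eq) (vertexAt-start i<m))
  vertexAt-branch {k = suc k} (_ , k<w) eq with vertexAt-inner (s≤s z≤n) k<w
  ... | _ , inner , _ with trans (sym eq) inner
  ... | ()

  vertexAt-subdividing : ∀ {i k d x} → Valid (i , k) → vertexAt (i , k) ≡ inj₂ (d , x) → d ≡ edge i
  vertexAt-subdividing {k = zero}  (i<m , _) eq with trans (sym eq) (vertexAt-start i<m)
  ... | ()
  vertexAt-subdividing {k = suc k} (_ , k<w) eq with vertexAt-inner (s≤s z≤n) k<w
  ... | _ , inner , _ = inj₂-edge (trans (sym eq) inner)

  0<m : 0 < m
  0<m = ≤-trans (s≤s z≤n) length≥3

  antiparallel : ∀ {i j} → i < m → j < m → vertex i ≡ vertex (sucMod m j) → vertex (sucMod m i) ≡ vertex j → ⊥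
  antiparallel {i} {j} i<m j<m i~sj si~j = sucMod²-≢ length≥3 j<m (trans (cong (sucMod m) sj≡i) si≡j)
    where
    sj≡i = sym (vertex-injective i _ i<m (sucMod<M j 0<m) i~sj)
    si≡j = vertex-injective _ j (sucMod<M i 0<m) j<m si~j

  edge-injective : ∀ {i j} → i < m → j < m → edge i ≡ edge j → i ≡ j
  edge-injective {i} {j} i<m j<m eq
    with forward i | edge-ends i i<m | forward j | edge-ends j j<m | cong (EGraph.ends H) eq
  ... | true  | ei | true  | ej | ends≡ = vertex-injective i j i<m j<m (cong proj₁ (trans (sym ei) (trans ends≡ ej)))
  ... | false | ei | false | ej | ends≡ = vertex-injective i j i<m j<m (cong proj₂ (trans (sym ei) (trans ends≡ ej)))
  ... | true  | ei | false | ej | ends≡ = ⊥-elim (antiparallel i<m j<m (cong proj₁ ends≡′) (cong proj₂ ends≡′))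
    where ends≡′ = trans (sym ei) (trans ends≡ ej)
  ... | false | ei | true  | ej | ends≡ = ⊥-elim (antiparallel i<m j<m (cong proj₂ ends≡′) (cong proj₁ ends≡′))
    where ends≡′ = trans (sym ei) (trans ends≡ ej)

  vertexAt-injective : ∀ {p q} → Valid p → Valid q → vertexAt p ≡ vertexAt q → p ≡ q
  vertexAt-injective {i , zero} {i′ , zero} (i<m , _) (i′<m , _) eq = cong (_, 0) (vertex-injective i i′ i<m i′<m
    (inj₁-injective (trans (sym (vertexAt-start i<m)) (trans eq (vertexAt-start i′<m)))))
  vertexAt-injective {i , zero} {i′ , suc k′} (i<m , _) (_ , k′<w) eq with vertexAt-inner (s≤s z≤n) k′<w
  ... | _ , inner , _ with trans (sym (vertexAt-start i<m)) (trans eq inner)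
  ... | ()
  vertexAt-injective {i , suc k} {i′ , zero} (_ , k<w) (i′<m , _) eq with vertexAt-inner (s≤s z≤n) k<w
  ... | _ , inner , _ with trans (sym inner) (trans eq (vertexAt-start i′<m))
  ... | ()
  vertexAt-injective {i , suc k} {i′ , suc k′} (i<m , k<w) (i′<m , k′<w) eq
    with vertexAt-inner (s≤s z≤n) k<w | vertexAt-inner (s≤s z≤n) k′<w
  ... | x , inner , x≡ | x′ , inner′ , x′≡
    with edge-injective i<m i′<m (inj₂-edge (trans (sym inner) (trans eq inner′)))
  ... | refl = cong (i ,_) (innerIndex-injective (forward i) (ℓ (edge i)) (s≤s z≤n) (≤-pred k<w) (s≤s z≤n) (≤-pred k′<w)
                 (trans (sym x≡) (trans (inj₂-index (trans (sym inner) (trans eq inner′))) x′≡)))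

  next : Position → Position
  next (i , k) with suc k <? w i
  ... | yes _ = (i , suc k)
  ... | no _  = (sucMod m i , 0)

  next-valid : ∀ {p} → Valid p → Valid (next p)
  next-valid {i , k} (i<m , _) with suc k <? w i
  ... | yes k+1<w = i<m , k+1<w
  ... | no _      = sucMod<M i 0<m , s≤s z≤n

  vertexAt-next : ∀ {i k} → Valid (i , k) → vertexAt (next (i , k)) ≡ vertexAt (i , suc k)
  vertexAt-next {i} {k} (i<m , k<w) with suc k <? w i
  ... | yes _     = refl
  ... | no k+1≮w rewrite ≤-antisym k<w (≮⇒≥ k+1≮w) =
        trans (vertexAt-start (sucMod<M i 0<m)) (sym (vertexAt-end i<m))

  index : Position → ℕ
  index (i , k) = sumBelow w i + k

  index<W : ∀ {p} → Valid p → index p < W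
  index<W {i , k} (i<m , k<w) = ≤-trans (+-monoʳ-< (sumBelow w i) k<w) (sumBelow-monoʳ-≤ w i<m)

  index-next : ∀ {p} → Valid p → index (next p) ≡ suc (index p) ⊎ (next p ≡ (0 , 0) × suc (index p) ≡ W)
  index-next {i , k} (i<m , k<w) with suc k <? w i
  ... | yes _ = inj₁ (+-suc (sumBelow w i) k)
  ... | no k+1≮w with sucMod-cases i i<m | ≤-antisym k<w (≮⇒≥ k+1≮w)
  ...   | inj₁ (_ , si≡)      | refl =
          inj₁ (trans (cong (λ j → sumBelow w j + 0) si≡) (trans (+-identityʳ _) (+-suc (sumBelow w i) _)))
  ...   | inj₂ (i+1≡m , si≡)  | refl =
          inj₂ (cong (_, 0) si≡ , trans (sym (+-suc (sumBelow w i) _)) (cong (sumBelow w) i+1≡m))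

  index-sucMod : ∀ {p} → Valid p → index (next p) ≡ sucMod W (index p)
  index-sucMod p-valid with index-next p-valid
  ... | inj₁ eq = trans eq (sym (sucMod-< (subst (_< W) eq (index<W (next-valid p-valid)))))
  ... | inj₂ (next≡ , p+1≡W) = trans (cong index next≡) (sym (sucMod-≡ p+1≡W))

  position : ℕ → Position
  position = locate w m

  position-valid : ∀ {t} → t < W → Valid (position t)
  position-valid t<W = let i<m , k<w , _ = locate-valid w {m} t<W in i<m , k<w

  index-position : ∀ {t} → t < W → index (position t) ≡ t
  index-position t<W = proj₂ (proj₂ (locate-valid w {m} t<W))

  position-index : ∀ {p} → Valid p → position (index p) ≡ p
  position-index (i<m , k<w) = locate-sumBelow w i<m k<w

  position-injective : ∀ {s t} → s < W → t < W → position s ≡ position t → s ≡ t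
  position-injective s<W t<W eq = trans (sym (index-position s<W)) (trans (cong index eq) (index-position t<W))

  position-sucMod : ∀ {t} → t < W → position (sucMod W t) ≡ next (position t)
  position-sucMod {t} t<W = begin
    position (sucMod W t)                    ≡⟨ cong (λ s → position (sucMod W s)) (sym (index-position t<W)) ⟩
    position (sucMod W (index (position t))) ≡⟨ cong position (sym (index-sucMod (position-valid t<W))) ⟩
    position (index (next (position t)))     ≡⟨ position-index (next-valid (position-valid t<W)) ⟩
    next (position t)                        ∎
    where open ≡-Reasoning

  stepEdge : Position → EGraph.E Hℓ
  stepEdge (i , k) with forward i
  ... | true  = edge i , k mod w i
  ... | false = edge i , (ℓ (edge i) ∸ k) mod w i

  stepEdge-joins : ∀ {i k} → k < w i →
                   Joins Hℓ (stepEdge (i , k)) (vertexAt (i , k)) (vertexAt (i , suc k))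
  stepEdge-joins {i} {k} k<w with forward i
  ... | true  rewrite toℕ-mod {k} k<w = inj₁ refl
  ... | false rewrite toℕ-mod {ℓ (edge i) ∸ k} (s≤s (m∸n≤m _ k)) | +-∸-assoc 1 (≤-pred k<w) = inj₂ refl

  edge-step : ∀ j {r} → r ≤ ℓ (edge j) → Σ[ k ∈ ℕ ] (k < w j ×
    ((pathVertex H ℓ (edge j) r ≡ vertexAt (j , k) × pathVertex H ℓ (edge j) (suc r) ≡ vertexAt (j , suc k)) ⊎
     (pathVertex H ℓ (edge j) r ≡ vertexAt (j , suc k) × pathVertex H ℓ (edge j) (suc r) ≡ vertexAt (j , k))))
  edge-step j {r} r≤ℓ with forward j
  ... | true  = r , s≤s r≤ℓ , inj₁ (refl , refl)
  ... | false = ℓ (edge j) ∸ r , s≤s (m∸n≤m _ r) ,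
                inj₂ (cong (pathVertex H ℓ (edge j)) (sym (m∸[m∸n]≡n r≤ℓ)) ,
                      cong (pathVertex H ℓ (edge j))
                           (sym (trans (+-∸-assoc 1 (m∸n≤m _ r)) (cong suc (m∸[m∸n]≡n r≤ℓ)))))

  on-cycle-edge : ChordsSubdivided ℓ C → ∀ {p q} d r → Valid p → Valid q → r ≤ ℓ d →
    pathVertex H ℓ d r ≡ vertexAt p → pathVertex H ℓ d (suc r) ≡ vertexAt q → Σ[ j ∈ ℕ ] (j < m × d ≡ edge j)
  on-cycle-edge _ {i , _} d (suc r) p-valid _ r<ℓ eq _ =
    i , proj₁ p-valid , vertexAt-subdividing p-valid (trans (sym eq) (pathVertex-inner H ℓ d r<ℓ))
  on-cycle-edge chords {i , _} {i′ , _} d zero p-valid q-valid _ eq eq′ with ℓ d ≟ 0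
  ... | no ℓ≢0  =
        i′ , proj₁ q-valid , vertexAt-subdividing q-valid (trans (sym eq′) (pathVertex-inner H ℓ d (n≢0⇒n>0 ℓ≢0)))
  ... | yes ℓ≡0 = chords d i i′ (proj₁ p-valid) (proj₁ q-valid)
                    (cong₂ _,_ (vertexAt-branch p-valid (sym eq))
                               (vertexAt-branch q-valid (trans (sym eq′) (pathVertex-last H ℓ d (≤-reflexive ℓ≡0)))))
                    ℓ≡0

  adjacent⇒consecutive : ChordsSubdivided ℓ C → ∀ {p q} d r → Valid p → Valid q → r ≤ ℓ d →
    pathVertex H ℓ d r ≡ vertexAt p → pathVertex H ℓ d (suc r) ≡ vertexAt q → q ≡ next p ⊎ p ≡ next q
  adjacent⇒consecutive chords d r p-valid q-valid r≤ℓ eq eq′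
    with on-cycle-edge chords d r p-valid q-valid r≤ℓ eq eq′
  ... | j , j<m , refl with edge-step j r≤ℓ
  ...   | k , k<w , inj₁ (a , b) =
          inj₁ (trans (vertexAt-injective q-valid (next-valid jk-valid) (trans (sym eq′) (trans b (sym jk-next))))
                      (cong next (vertexAt-injective jk-valid p-valid (trans (sym a) eq))))
    where
    jk-valid = j<m , k<w
    jk-next = vertexAt-next jk-valid
  ...   | k , k<w , inj₂ (a , b) =
          inj₂ (trans (vertexAt-injective p-valid (next-valid jk-valid) (trans (sym eq) (trans a (sym jk-next))))
                      (cong next (vertexAt-injective jk-valid q-valid (trans (sym b) eq′))))
    where
    jk-valid = j<m , k<w
    jk-next = vertexAt-next jk-valid

  W≥3 : 3 ≤ W
  W≥3 = ≤-trans length≥3 (sumBelow-≥ (λ _ → s≤s z≤n) m)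

  0<W : 0 < W
  0<W = ≤-trans (s≤s z≤n) W≥3

  vertexOf : ℕ → SubV H ℓ
  vertexOf t = vertexAt (position t)

  vertexOf-injective : ∀ s t → s < W → t < W → vertexOf s ≡ vertexOf t → s ≡ t
  vertexOf-injective s t s<W t<W eq =
    position-injective s<W t<W (vertexAt-injective (position-valid s<W) (position-valid t<W) eq)

  next⇒sucMod : ∀ {s t} → s < W → t < W → position t ≡ next (position s) → t ≡ sucMod W s
  next⇒sucMod s<W t<W eq = position-injective t<W (sucMod<M _ 0<W) (trans eq (sym (position-sucMod s<W)))

  edgeOf : ℕ → EGraph.E Hℓ
  edgeOf t = stepEdge (position t)

  edgeOf-joins : ∀ {t} → t < W → Joins Hℓ (edgeOf t) (vertexOf t) (vertexOf (sucMod W t))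
  edgeOf-joins {t} t<W =
    subst (Joins Hℓ (edgeOf t) (vertexOf t))
          (sym (trans (cong vertexAt (position-sucMod t<W)) (vertexAt-next (position-valid t<W))))
          (stepEdge-joins (proj₂ (position-valid t<W)))

  subdivision-embedding : ChordsSubdivided ℓ C → cycleGraph W ↪ toGraph Hℓ
  subdivision-embedding chords =
    cycle↪ (toGraph Hℓ) vertexOf (toGraph-sym Hℓ) vertexOf-injective
      (λ t t<W → edgeOf t , edgeOf-joins t<W) steps-only
    where
    steps-only : ∀ s t → s < W → t < W → Graph.Adj (toGraph Hℓ) (vertexOf s) (vertexOf t) →
                 t ≡ sucMod W s ⊎ s ≡ sucMod W t
    steps-only s t s<W t<W ((d , r) , joins) with joins
    ... | inj₁ ends≡ = Sum.map (next⇒sucMod s<W t<W) (next⇒sucMod t<W s<W)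
                         (adjacent⇒consecutive chords d (toℕ r) (position-valid s<W) (position-valid t<W) r≤ℓ
                           (cong proj₁ ends≡) (cong proj₂ ends≡))
      where r≤ℓ = ≤-pred (toℕ<n r)
    ... | inj₂ ends≡ = Sum.swap (Sum.map (next⇒sucMod t<W s<W) (next⇒sucMod s<W t<W)
                         (adjacent⇒consecutive chords d (toℕ r) (position-valid t<W) (position-valid s<W) r≤ℓ
                           (cong proj₁ ends≡) (cong proj₂ ends≡)))
      where r≤ℓ = ≤-pred (toℕ<n r)

  ends-of-edgeOf : ∀ {t x} → t < W → IsEnd Hℓ x (edgeOf t) →
                   x ≡ vertexOf t ⊎ x ≡ vertexOf (sucMod W t)
  ends-of-edgeOf t<W = isEnd-joins Hℓ (edgeOf-joins t<W)

  edgeOf-injective : ∀ s t → s < W → t < W → edgeOf s ≡ edgeOf t → s ≡ t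
  edgeOf-injective s t s<W t<W eq
    with ends-of-edgeOf t<W (subst (IsEnd Hℓ (vertexOf s)) eq (joins-isEnd₁ Hℓ (edgeOf-joins s<W)))
       | ends-of-edgeOf t<W (subst (IsEnd Hℓ (vertexOf (sucMod W s))) eq (joins-isEnd₂ Hℓ (edgeOf-joins s<W)))
  ... | inj₁ s~t | _ = vertexOf-injective s t s<W t<W s~t
  ... | inj₂ _ | inj₂ s+1~t+1 =
        sucMod-injective s<W t<W (vertexOf-injective _ _ (sucMod<M s 0<W) (sucMod<M t 0<W) s+1~t+1)
  ... | inj₂ s~t+1 | inj₁ s+1~t = ⊥-elim (sucMod²-≢ W≥3 t<W
        (trans (cong (sucMod W) (sym (vertexOf-injective s _ s<W (sucMod<M t 0<W) s~t+1)))
               (vertexOf-injective _ t (sucMod<M s 0<W) t<W s+1~t)))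

  lineGraph-embedding : cycleGraph W ↪ lineGraph Hℓ
  lineGraph-embedding =
    cycle↪ (lineGraph Hℓ) edgeOf (lineGraph-sym Hℓ) edgeOf-injective step steps-only
    where
    step : ∀ t → t < W → Graph.Adj (lineGraph Hℓ) (edgeOf t) (edgeOf (sucMod W t))
    step t t<W = lineGraph-adj Hℓ
      (λ eq → sucMod-≢ (≤-trans (s≤s (s≤s z≤n)) W≥3) t<W (sym (edgeOf-injective t _ t<W (sucMod<M t 0<W) eq)))
      (joins-isEnd₂ Hℓ (edgeOf-joins t<W)) (joins-isEnd₁ Hℓ (edgeOf-joins (sucMod<M t 0<W)))

    steps-only : ∀ s t → s < W → t < W → Graph.Adj (lineGraph Hℓ) (edgeOf s) (edgeOf t) →
                 t ≡ sucMod W s ⊎ s ≡ sucMod W t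
    steps-only s t s<W t<W adj@(s≢t , _) with lineGraph-common Hℓ adj
    ... | x , x∈s , x∈t with ends-of-edgeOf s<W x∈s | ends-of-edgeOf t<W x∈t
    ...   | inj₁ refl | inj₁ s~t     = ⊥-elim (s≢t (cong edgeOf (vertexOf-injective s t s<W t<W s~t)))
    ...   | inj₁ refl | inj₂ s~t+1   = inj₂ (vertexOf-injective s _ s<W (sucMod<M t 0<W) s~t+1)
    ...   | inj₂ refl | inj₁ s+1~t   = inj₁ (sym (vertexOf-injective _ t (sucMod<M s 0<W) t<W s+1~t))
    ...   | inj₂ refl | inj₂ s+1~t+1 = ⊥-elim (s≢t (cong edgeOf
            (sucMod-injective s<W t<W (vertexOf-injective _ _ (sucMod<M s 0<W) (sucMod<M t 0<W) s+1~t+1))))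

module _ {H : EGraph} (ℓ : EGraph.E H → ℕ) {m : ℕ} (C : Cycle H m) {n : ℕ} (G : FinGraph n) where
  open SubdividedCycle ℓ C using (W≥3; subdivision-embedding; lineGraph-embedding)

  subdivision-inducedCycle : ChordsSubdivided ℓ C → InducedIn (toGraph (subdivide H ℓ)) G →
                             HasInducedCycle G (subdividedLength ℓ C)
  subdivision-inducedCycle chords H↪G = W≥3 , ↪-inducedIn G (subdivision-embedding chords) H↪G

  lineGraph-inducedCycle : InducedIn (lineGraph (subdivide H ℓ)) G → HasInducedCycle G (subdividedLength ℓ C)
  lineGraph-inducedCycle L↪G = W≥3 , ↪-inducedIn G lineGraph-embedding L↪G

-- The fallback edge is only ever chosen between non-adjacent vertices.
module EdgesOfRelation {V : Set} (R : V → V → Set) (R? : Decidable R)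
  (R-irrelevant : ∀ {x y} (p q : R x y) → p ≡ q) (R-asym : ∀ {x y} → R x y → R y x → ⊥)
  (fallback : EGraph.E (fromRel V R)) where

  Adjacent : V → V → Set
  Adjacent x y = R x y ⊎ R y x

  -- Abstract: unfolding R? while comparing lengths of concrete cycles makes type checking very slow.
  abstract
    edgeBetween : V → V → EGraph.E (fromRel V R)
    edgeBetween x y with R? x y | R? y x
    ... | yes p | _     = (x , y) , p
    ... | no _  | yes q = (y , x) , q
    ... | no _  | no _  = fallback

    isForward : V → V → Bool
    isForward x y with R? x y
    ... | yes _ = true
    ... | no _  = false

    edgeBetween-ends : ∀ {x y} → Adjacent x y →
      EGraph.ends (fromRel V R) (edgeBetween x y) ≡ (if isForward x y then (x , y) else (y , x))
    edgeBetween-ends {x} {y} adj with R? x y | R? y x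
    ... | yes _ | _     = refl
    ... | no _  | yes _ = refl
    ... | no ¬p | no ¬q with adj
    ...   | inj₁ p = ⊥-elim (¬p p)
    ...   | inj₂ q = ⊥-elim (¬q q)

    edgeBetween-forward : ∀ {x y} (p : R x y) → edgeBetween x y ≡ ((x , y) , p)
    edgeBetween-forward {x} {y} p with R? x y
    ... | yes p′ = cong ((x , y) ,_) (R-irrelevant p′ p)
    ... | no ¬p  = ⊥-elim (¬p p)

    edgeBetween-backward : ∀ {x y} (p : R x y) → edgeBetween y x ≡ ((x , y) , p)
    edgeBetween-backward {x} {y} p with R? y x | R? x y
    ... | yes q | _      = ⊥-elim (R-asym p q)
    ... | no _  | yes p′ = cong ((x , y) ,_) (R-irrelevant p′ p)
    ... | no _  | no ¬p  = ⊥-elim (¬p p)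

  edgeBetween-comm : ∀ {x y} → Adjacent x y → edgeBetween x y ≡ edgeBetween y x
  edgeBetween-comm (inj₁ p) = trans (edgeBetween-forward p) (sym (edgeBetween-backward p))
  edgeBetween-comm (inj₂ q) = trans (edgeBetween-backward q) (sym (edgeBetween-forward q))

  module _ {m : ℕ} (u : ℕ → V) where

    relCycle : 3 ≤ m → (∀ i → i < m → Adjacent (u i) (u (sucMod m i))) →
               (∀ i j → i < m → j < m → u i ≡ u j → i ≡ j) → Cycle (fromRel V R) m
    relCycle 3≤m steps u-injective = record
      { length≥3         = 3≤m
      ; vertex           = u
      ; edge             = λ i → edgeBetween (u i) (u (sucMod m i))
      ; forward          = λ i → isForward (u i) (u (sucMod m i))
      ; edge-ends        = λ i i<m → edgeBetween-ends (steps i i<m)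
      ; vertex-injective = u-injective
      }

    relCycle-chordsSubdivided : ∀ 3≤m steps u-injective →
      (∀ i j → i < m → j < m → R (u i) (u j) → j ≡ sucMod m i ⊎ i ≡ sucMod m j) →
      (ℓ : EGraph.E (fromRel V R) → ℕ) → ChordsSubdivided ℓ (relCycle 3≤m steps u-injective)
    relCycle-chordsSubdivided _ _ _ only-steps ℓ ((x , y) , p) i j i<m j<m refl _ with only-steps i j i<m j<m p
    ... | inj₁ j≡ = i , i<m , sym (trans (cong (λ k → edgeBetween (u i) (u k)) (sym j≡)) (edgeBetween-forward p))
    ... | inj₂ i≡ = j , j<m , sym (trans (cong (λ k → edgeBetween (u j) (u k)) (sym i≡)) (edgeBetween-backward p))

module CompleteGraph (f′ : ℕ) where

  f : ℕ
  f = suc (suc f′)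

  open EdgesOfRelation {Fin f} (λ x y → toℕ x < toℕ y) (λ x y → toℕ x <? toℕ y) <-irrelevant <-asym
    ((0 mod f , 1 mod f) , s≤s z≤n) public

  vertex : ℕ → Fin f
  vertex x = x mod f

  module _ (ℓ : EGraph.E (complete f) → ℕ) where

    pathWeight : ℕ → ℕ
    pathWeight t = suc (ℓ (edgeBetween (vertex (suc t)) (vertex (suc (suc t)))))

    hubWeight : ℕ → ℕ
    hubWeight x = suc (ℓ (edgeBetween (vertex 0) (vertex (suc x))))

    pathLength : ℕ → ℕ
    pathLength = sumBelow pathWeight

  module HubCycle (a L : ℕ) where

    m : ℕ
    m = suc (suc L)

    u : ℕ → Fin f
    u i with i ≤? L
    ... | yes _ = vertex (suc (i + a))
    ... | no _  = vertex 0

    u-path : ∀ {i} → i ≤ L → u i ≡ vertex (suc (i + a))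
    u-path {i} i≤L with i ≤? L
    ... | yes _  = refl
    ... | no i≰L = ⊥-elim (i≰L i≤L)

    u-hub : u (suc L) ≡ vertex 0
    u-hub with suc L ≤? L
    ... | yes L+1≤L = ⊥-elim (<-irrefl refl L+1≤L)
    ... | no _      = refl

    sucMod-path : ∀ {i} → i < L → sucMod m i ≡ suc i
    sucMod-path i<L = sucMod-< (s≤s (m<n⇒m<1+n i<L))

    cycleLength : (EGraph.E (complete f) → ℕ) → ℕ
    cycleLength ℓ = sumBelow (λ i → suc (ℓ (edgeBetween (u i) (u (sucMod m i))))) m

    index-cases : ∀ {i} → i < m → i ≤ L ⊎ i ≡ suc L
    index-cases (s≤s i≤L+1) with m≤n⇒m<n∨m≡n i≤L+1
    ... | inj₁ i<L+1 = inj₁ (≤-pred i<L+1)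
    ... | inj₂ i≡L+1 = inj₂ i≡L+1

    module _ (1≤L : 1 ≤ L) (L+a<f : suc (L + a) < f) where

      toℕ-u-path : ∀ {i} → i ≤ L → toℕ (u i) ≡ suc (i + a)
      toℕ-u-path i≤L = trans (cong toℕ (u-path i≤L)) (toℕ-mod (≤-trans (s≤s (s≤s (+-monoˡ-≤ a i≤L))) L+a<f))

      steps : ∀ i → i < m → Adjacent (u i) (u (sucMod m i))
      steps i i<m with index-cases i<m
      ... | inj₂ refl rewrite sucMod-≡ {m} {suc L} refl | u-hub | toℕ-u-path {0} z≤n = inj₁ (s≤s z≤n)
      ... | inj₁ i≤L with m≤n⇒m<n∨m≡n i≤L
      ...   | inj₁ i<L rewrite sucMod-path i<L | toℕ-u-path (<⇒≤ i<L) | toℕ-u-path i<L = inj₁ ≤-refl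
      ...   | inj₂ refl rewrite sucMod-< {m} {L} ≤-refl | u-hub | toℕ-u-path {L} ≤-refl = inj₂ (s≤s z≤n)

      path≢hub : ∀ {i} → i ≤ L → u i ≢ u (suc L)
      path≢hub i≤L eq = 1+n≢0 (trans (sym (toℕ-u-path i≤L)) (trans (cong toℕ eq) (cong toℕ u-hub)))

      u-injective : ∀ i j → i < m → j < m → u i ≡ u j → i ≡ j
      u-injective i j i<m j<m eq with index-cases i<m | index-cases j<m
      ... | inj₁ i≤L  | inj₁ j≤L  =
            +-cancelʳ-≡ a i j (suc-injective (trans (sym (toℕ-u-path i≤L)) (trans (cong toℕ eq) (toℕ-u-path j≤L))))
      ... | inj₁ i≤L  | inj₂ refl = ⊥-elim (path≢hub i≤L eq)
      ... | inj₂ refl | inj₁ j≤L  = ⊥-elim (path≢hub j≤L (sym eq))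
      ... | inj₂ refl | inj₂ refl = refl

      cycle : Cycle (complete f) m
      cycle = relCycle u (s≤s (s≤s 1≤L)) steps u-injective

      module _ (ℓ : EGraph.E (complete f) → ℕ) where

        weight : ℕ → ℕ
        weight i = suc (ℓ (edgeBetween (u i) (u (sucMod m i))))

        weight-path : ∀ {i} → i < L → weight i ≡ pathWeight ℓ (i + a)
        weight-path {i} i<L rewrite sucMod-path i<L | u-path (<⇒≤ i<L) | u-path i<L = refl

        weight-last : weight L ≡ hubWeight ℓ (L + a)
        weight-last = begin
          suc (ℓ (edgeBetween (u L) (u (sucMod m L))))
            ≡⟨ cong (λ e → suc (ℓ e)) (edgeBetween-comm (steps L (s≤s (n≤1+n L)))) ⟩
          suc (ℓ (edgeBetween (u (sucMod m L)) (u L)))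
            ≡⟨ cong₂ (λ x y → suc (ℓ (edgeBetween x y))) (trans (cong u (sucMod-< ≤-refl)) u-hub) (u-path ≤-refl) ⟩
          hubWeight ℓ (L + a) ∎
          where open ≡-Reasoning

        weight-hub : weight (suc L) ≡ hubWeight ℓ a
        weight-hub =
          cong₂ (λ x y → suc (ℓ (edgeBetween x y))) u-hub (trans (cong u (sucMod-≡ {m} {suc L} refl)) (u-path z≤n))

        cycleLength-potential :
          cycleLength ℓ + pathLength ℓ a ≡ pathLength ℓ (L + a) + hubWeight ℓ a + hubWeight ℓ (L + a)
        cycleLength-potential = begin
          sumBelow weight L + weight L + weight (suc L) + pathLength ℓ a
            ≡⟨ cong (λ x → x + weight L + weight (suc L) + pathLength ℓ a) (sumBelow-cong L (λ _ → weight-path)) ⟩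
          P + weight L + weight (suc L) + pathLength ℓ a
            ≡⟨ cong₂ (λ x y → P + x + y + pathLength ℓ a) weight-last weight-hub ⟩
          P + hubWeight ℓ (L + a) + hubWeight ℓ a + pathLength ℓ a
            ≡⟨ rearrange P (hubWeight ℓ (L + a)) (hubWeight ℓ a) (pathLength ℓ a) ⟩
          pathLength ℓ a + P + hubWeight ℓ a + hubWeight ℓ (L + a)
            ≡⟨ cong (λ x → x + hubWeight ℓ a + hubWeight ℓ (L + a)) (sym (sumBelow-split (pathWeight ℓ) L a)) ⟩
          pathLength ℓ (L + a) + hubWeight ℓ a + hubWeight ℓ (L + a) ∎
          where
          open ≡-Reasoning
          P = sumBelow (λ i → pathWeight ℓ (i + a)) L
          rearrange : ∀ p x y s → p + x + y + s ≡ s + p + y + x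
          rearrange = solve-∀

        cycleLength-induced : ∀ {n} (G : FinGraph n) → Proper (complete f) ℓ →
          InducedIn (toGraph (subdivide (complete f) ℓ)) G → HasInducedCycle G (cycleLength ℓ)
        cycleLength-induced G proper =
          subdivision-inducedCycle ℓ cycle G (λ d _ _ _ _ _ ℓd≡0 → ⊥-elim (<-irrefl (sym ℓd≡0) (proper d)))

WallStep : ℕ × ℕ → ℕ × ℕ → Set
WallStep (i , j) (i′ , j′) = (i ≡ i′ × suc j ≡ j′) ⊎ (j ≡ j′ × suc i ≡ i′ × (i + j) % 2 ≡ 0)

step-target : ∀ {r c q} → WallStep (r , c) q → q ≡ (r , suc c) ⊎ (q ≡ (suc r , c) × (r + c) % 2 ≡ 0)
step-target (inj₁ (e₁ , e₂))          = inj₁ (cong₂ _,_ (sym e₁) (sym e₂))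
step-target (inj₂ (e₁ , e₂ , parity)) = inj₂ (cong₂ _,_ (sym e₂) (sym e₁) , parity)

-- The boundary of the 3-row ladder on columns 0 … L+1: along row 0 to column L, down to
-- (1 , L), (1 , L+1), (2 , L+1), back along row 2 to column 1, then (1 , 1), (1 , 0).
module Ladder (L : ℕ) where

  B : ℕ
  B = suc L

  m : ℕ
  m = 4 + B + B

  ladder₂ : ℕ → ℕ × ℕ
  ladder₂ zero    = (1 , 1)
  ladder₂ (suc _) = (1 , 0)

  ladder₁ : ℕ → ℕ × ℕ
  ladder₁ zero          = (1 , L)
  ladder₁ (suc zero)    = (1 , B)
  ladder₁ (suc (suc s)) with s <? B
  ... | yes _ = (2 , B ∸ s)
  ... | no _  = ladder₂ (s ∸ B)

  ladder : ℕ → ℕ × ℕ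
  ladder i with i <? B
  ... | yes _ = (0 , i)
  ... | no _  = ladder₁ (i ∸ B)

  data Segment : ℕ → ℕ × ℕ → Set where
    top        : ∀ {t} → t < L → Segment t (0 , t)
    top-end    : Segment L (0 , L)
    right      : Segment B (1 , L)
    right-end  : Segment (suc B) (1 , B)
    bottom     : ∀ {s} → s < L → Segment (2 + s + B) (2 , B ∸ s)
    bottom-end : Segment (2 + L + B) (2 , 1)
    left       : Segment (2 + B + B) (1 , 1)
    left-end   : Segment (3 + B + B) (1 , 0)

  ladder-top : ∀ {t} → t < B → ladder t ≡ (0 , t)
  ladder-top {t} t<B with t <? B
  ... | yes _   = refl
  ... | no t≮B  = ⊥-elim (t≮B t<B)

  ladder-beyond : ∀ k → ladder (k + B) ≡ ladder₁ k
  ladder-beyond k with k + B <? B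
  ... | yes k+B<B = ⊥-elim (m+n≮n k B k+B<B)
  ... | no _      = cong ladder₁ (m+n∸n≡m k B)

  ladder₁-bottom : ∀ {s} → s < B → ladder₁ (2 + s) ≡ (2 , B ∸ s)
  ladder₁-bottom {s} s<B with s <? B
  ... | yes _  = refl
  ... | no s≮B = ⊥-elim (s≮B s<B)

  ladder₁-left : ∀ j → ladder₁ (2 + (j + B)) ≡ ladder₂ j
  ladder₁-left j with j + B <? B
  ... | yes j+B<B = ⊥-elim (m+n≮n j B j+B<B)
  ... | no _      = cong ladder₂ (m+n∸n≡m j B)

  ladder-bottom : ∀ {s} → s < B → ladder (2 + s + B) ≡ (2 , B ∸ s)
  ladder-bottom {s} s<B = trans (ladder-beyond (2 + s)) (ladder₁-bottom s<B)

  ladder-at : ∀ {i p} → Segment i p → ladder i ≡ p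
  ladder-at (top t<L)    = ladder-top (m<n⇒m<1+n t<L)
  ladder-at top-end      = ladder-top ≤-refl
  ladder-at right        = ladder-beyond 0
  ladder-at right-end    = ladder-beyond 1
  ladder-at (bottom s<L) = ladder-bottom (m<n⇒m<1+n s<L)
  ladder-at bottom-end   = trans (ladder-bottom ≤-refl) (cong (2 ,_) (m+n∸n≡m 1 L))
  ladder-at left         = trans (ladder-beyond (2 + B)) (ladder₁-left 0)
  ladder-at left-end     = trans (ladder-beyond (3 + B)) (ladder₁-left 1)

  offset< : ∀ {k} → k ≤ 3 + B → k + B < m
  offset< k≤3+B = +-monoˡ-< B (s≤s k≤3+B)

  segment-index< : ∀ {i p} → Segment i p → i < m
  segment-index< (top t<L)    = <-trans t<L (<-trans (n<1+n L) (offset< z≤n))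
  segment-index< top-end      = <-trans (n<1+n L) (offset< z≤n)
  segment-index< right        = offset< z≤n
  segment-index< right-end    = offset< (s≤s z≤n)
  segment-index< (bottom s<L) = offset< (s≤s (s≤s (≤-trans (<⇒≤ s<L) (m≤n+m L 2))))
  segment-index< bottom-end   = offset< (s≤s (s≤s (m≤n+m L 2)))
  segment-index< left         = offset< (s≤s (s≤s (n≤1+n B)))
  segment-index< left-end     = offset< ≤-refl

  sucMod-segment : ∀ {i q} → Segment (suc i) q → sucMod m i ≡ suc i
  sucMod-segment σ = sucMod-< (segment-index< σ)

  private
    classify₂ : ∀ j → 2 + (j + B) + B < m → Σ[ p ∈ ℕ × ℕ ] Segment (2 + (j + B) + B) p
    classify₂ zero          _     = _ , left
    classify₂ (suc zero)    _     = _ , left-end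
    classify₂ (suc (suc j)) j+4<m =
      ⊥-elim (m+n≮n j B (≤-pred (≤-pred (≤-pred (≤-pred (+-cancelʳ-< B _ _ j+4<m))))))

    classify₁ : ∀ k → k + B < m → Σ[ p ∈ ℕ × ℕ ] Segment (k + B) p
    classify₁ zero          _   = _ , right
    classify₁ (suc zero)    _   = _ , right-end
    classify₁ (suc (suc s)) k<m with s <? B
    ... | yes s<B with m≤n⇒m<n∨m≡n (≤-pred s<B)
    ...   | inj₁ s<L  = _ , bottom s<L
    ...   | inj₂ refl = _ , bottom-end
    classify₁ (suc (suc s)) k<m | no s≮B =
      subst (λ z → Σ[ p ∈ ℕ × ℕ ] Segment (2 + z + B) p) s∸B+B≡s
            (classify₂ (s ∸ B) (subst (λ z → 2 + z + B < m) (sym s∸B+B≡s) k<m))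
      where s∸B+B≡s = m∸n+n≡m (≮⇒≥ s≮B)

  classify : ∀ {i} → i < m → Σ[ p ∈ ℕ × ℕ ] Segment i p
  classify {i} i<m with i <? B
  ... | yes i<B with m≤n⇒m<n∨m≡n (≤-pred i<B)
  ...   | inj₁ i<L  = _ , top i<L
  ...   | inj₂ refl = _ , top-end
  classify {i} i<m | no i≮B =
    subst (λ z → Σ[ p ∈ ℕ × ℕ ] Segment z p) i∸B+B≡i (classify₁ (i ∸ B) (subst (_< m) (sym i∸B+B≡i) i<m))
    where i∸B+B≡i = m∸n+n≡m (≮⇒≥ i≮B)

  segment : ∀ {i} → i < m → Segment i (ladder i)
  segment i<m with classify i<m
  ... | _ , σ = subst (Segment _) (sym (ladder-at σ)) σ

  segment-of : ∀ {j q} → j < m → ladder j ≡ q → Segment j q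
  segment-of j<m refl = segment j<m

  row₀ : ∀ {j y} → Segment j (0 , y) → j ≡ y × y ≤ L
  row₀ (top t<L) = refl , <⇒≤ t<L
  row₀ top-end   = refl , ≤-refl

  row₁ : ∀ {j y} → Segment j (1 , y) →
    (j ≡ B × y ≡ L) ⊎ (j ≡ suc B × y ≡ B) ⊎ (j ≡ 2 + B + B × y ≡ 1) ⊎ (j ≡ 3 + B + B × y ≡ 0)
  row₁ right     = inj₁ (refl , refl)
  row₁ right-end = inj₂ (inj₁ (refl , refl))
  row₁ left      = inj₂ (inj₂ (inj₁ (refl , refl)))
  row₁ left-end  = inj₂ (inj₂ (inj₂ (refl , refl)))

  row₂ : ∀ {j y} → Segment j (2 , y) → Σ[ s ∈ ℕ ] (s ≤ L × j ≡ 2 + s + B × y ≡ B ∸ s)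
  row₂ (bottom {s} s<L) = s , <⇒≤ s<L , refl , refl
  row₂ bottom-end       = L , ≤-refl , refl , sym (m+n∸n≡m 1 L)

  row₃ : ∀ {j r y} → ¬ Segment j (3 + r , y)
  row₃ ()

  ladder-sum : ∀ f {t a b c t′ d e g} →
    sumBelow f L ≡ t → f L ≡ a → f B ≡ b → f (suc B) ≡ c →
    sumBelow (λ s → f (2 + s + B)) L ≡ t′ → f (2 + L + B) ≡ d → f (2 + B + B) ≡ e → f (3 + B + B) ≡ g →
    sumBelow f m ≡ t + a + (b + (c + (t′ + d))) + e + g
  ladder-sum f refl refl refl refl refl refl refl refl = cong (λ x → x + f (2 + B + B) + f (3 + B + B)) (begin
    sumBelow f (2 + B + B)                                         ≡⟨ sumBelow-split f (2 + B) B ⟩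
    sumBelow f B + sumBelow (λ k → f (k + B)) (2 + B)              ≡⟨ cong (sumBelow f B +_)
                                                                            (sumBelow-shift _ (suc B)) ⟩
    sumBelow f B + (f B + sumBelow (λ k → f (suc k + B)) (suc B))  ≡⟨ cong (λ x → sumBelow f B + (f B + x))
                                                                            (sumBelow-shift _ B) ⟩
    sumBelow f B + (f B + (f (suc B) + sumBelow (λ s → f (2 + s + B)) B)) ∎)
    where open ≡-Reasoning

  private
    bottom-pred : ∀ {s s′} → s ≤ L → s′ ≤ L → suc (B ∸ s) ≡ B ∸ s′ → s ≡ suc s′
    bottom-pred {s} {s′} s≤L s′≤L eq = sym (+-cancelˡ-≡ (B ∸ s) _ _ (begin
      B ∸ s + suc s′  ≡⟨ +-suc (B ∸ s) s′ ⟩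
      suc (B ∸ s) + s′ ≡⟨ cong (_+ s′) eq ⟩
      B ∸ s′ + s′      ≡⟨ m∸n+n≡m (m≤n⇒m≤1+n s′≤L) ⟩
      B                ≡⟨ sym (m∸n+n≡m (m≤n⇒m≤1+n s≤L)) ⟩
      B ∸ s + s        ∎))
      where open ≡-Reasoning

  -- L even makes the four changes of row vertical wall edges; L ≥ 3 keeps the corners on row 1
  -- apart and pairwise non-adjacent, so that the boundary is an induced cycle of the wall.
  module _ (3≤L : 3 ≤ L) where

    private
      small≢L : ∀ {k} → k < 3 → k ≢ L
      small≢L k<3 k≡L = <⇒≱ k<3 (subst (3 ≤_) (sym k≡L) 3≤L)

      0<L : 0 < L
      0<L = ≤-trans (s≤s z≤n) 3≤L

    segment-injective : ∀ {i j p} → Segment i p → Segment j p → i ≡ j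
    segment-injective (top _) τ = sym (proj₁ (row₀ τ))
    segment-injective top-end τ = sym (proj₁ (row₀ τ))
    segment-injective right τ with row₁ τ
    ... | inj₁ (refl , _)                = refl
    ... | inj₂ (inj₁ (_ , L≡B))          = ⊥-elim (1+n≢n (sym L≡B))
    ... | inj₂ (inj₂ (inj₁ (_ , L≡1)))   = ⊥-elim (small≢L (s≤s (s≤s z≤n)) (sym L≡1))
    ... | inj₂ (inj₂ (inj₂ (_ , L≡0)))   = ⊥-elim (small≢L (s≤s z≤n) (sym L≡0))
    segment-injective right-end τ with row₁ τ
    ... | inj₁ (_ , B≡L)                 = ⊥-elim (1+n≢n B≡L)
    ... | inj₂ (inj₁ (refl , _))         = refl
    ... | inj₂ (inj₂ (inj₁ (_ , B≡1)))   = ⊥-elim (small≢L (s≤s z≤n) (sym (suc-injective B≡1)))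
    ... | inj₂ (inj₂ (inj₂ (_ , ())))
    segment-injective (bottom s<L) τ with row₂ τ
    ... | s′ , s′≤L , refl , eq = cong (λ z → 2 + z + B) (∸-cancelˡ-≡ (m≤n⇒m≤1+n (<⇒≤ s<L)) (m≤n⇒m≤1+n s′≤L) eq)
    segment-injective bottom-end τ with row₂ τ
    ... | s′ , s′≤L , refl , eq =
          cong (λ z → 2 + z + B) (∸-cancelˡ-≡ (n≤1+n L) (m≤n⇒m≤1+n s′≤L) (trans (m+n∸n≡m 1 L) eq))
    segment-injective left τ with row₁ τ
    ... | inj₁ (_ , 1≡L)                 = ⊥-elim (small≢L (s≤s (s≤s z≤n)) 1≡L)
    ... | inj₂ (inj₁ (_ , 1≡B))          = ⊥-elim (small≢L (s≤s z≤n) (suc-injective 1≡B))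
    ... | inj₂ (inj₂ (inj₁ (refl , _)))  = refl
    ... | inj₂ (inj₂ (inj₂ (_ , ())))
    segment-injective left-end τ with row₁ τ
    ... | inj₁ (_ , 0≡L)                 = ⊥-elim (small≢L (s≤s z≤n) 0≡L)
    ... | inj₂ (inj₁ (_ , ()))
    ... | inj₂ (inj₂ (inj₁ (_ , ())))
    ... | inj₂ (inj₂ (inj₂ (refl , _)))  = refl

    module _ (L-even : L % 2 ≡ 0) where

      B+1-even : (1 + B) % 2 ≡ 0
      B+1-even = trans (cong (_% 2) (+-comm 2 L)) (trans ([m+n]%n≡m%n L 2) L-even)

      L+1-odd : (1 + L) % 2 ≡ 1
      L+1-odd = trans (%-distribˡ-+ 1 L 2) (cong (λ x → (1 + x) % 2) L-even)

      ladder-step : ∀ {i p} → Segment i p → WallStep p (ladder (sucMod m i)) ⊎ WallStep (ladder (sucMod m i)) p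
      ladder-step (top {t} t<L)
        rewrite sucMod-< (≤-<-trans t<L (segment-index< top-end)) | ladder-top {suc t} (s≤s t<L) =
        inj₁ (inj₁ (refl , refl))
      ladder-step top-end   rewrite sucMod-segment right | ladder-at right = inj₁ (inj₂ (refl , refl , L-even))
      ladder-step right     rewrite sucMod-segment right-end | ladder-at right-end = inj₁ (inj₁ (refl , refl))
      ladder-step right-end
        rewrite sucMod-segment (bottom {0} (≤-trans (s≤s z≤n) 3≤L)) | ladder-bottom {0} (s≤s z≤n) =
        inj₁ (inj₂ (refl , refl , B+1-even))
      ladder-step (bottom {s} s<L) rewrite sucMod-< (offset< (s≤s (s≤s (s≤s (≤-trans (<⇒≤ s<L) (n≤1+n L))))))
                                         | ladder-bottom {suc s} (s≤s s<L) =
        inj₂ (inj₁ (refl , sym (+-∸-assoc 1 (<⇒≤ s<L))))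
      ladder-step bottom-end rewrite sucMod-segment left | ladder-at left = inj₂ (inj₂ (refl , refl , refl))
      ladder-step left       rewrite sucMod-segment left-end | ladder-at left-end = inj₂ (inj₁ (refl , refl))
      ladder-step left-end   rewrite sucMod-≡ {m} {3 + B + B} refl | ladder-top {0} (s≤s z≤n) =
        inj₂ (inj₂ (refl , refl , refl))

      ladder-only-steps : ∀ {i p j} → Segment i p → j < m → WallStep p (ladder j) → j ≡ sucMod m i ⊎ i ≡ sucMod m j
      ladder-only-steps (top t<L) j<m step with step-target step
      ... | inj₁ eq =
            inj₁ (trans (proj₁ (row₀ (segment-of j<m eq))) (sym (sucMod-< (≤-<-trans t<L (segment-index< top-end)))))
      ... | inj₂ (eq , parity) with row₁ (segment-of j<m eq)
      ...   | inj₁ (_ , refl)                = ⊥-elim (<-irrefl refl t<L)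
      ...   | inj₂ (inj₁ (_ , refl))         = ⊥-elim (<-asym t<L (n<1+n L))
      ...   | inj₂ (inj₂ (inj₁ (_ , refl)))  = ⊥-elim (1+n≢0 parity)
      ...   | inj₂ (inj₂ (inj₂ (refl , refl))) = inj₂ (sym (sucMod-≡ refl))
      ladder-only-steps top-end j<m step with step-target step
      ... | inj₁ eq = ⊥-elim (<⇒≱ (n<1+n L) (proj₂ (row₀ (segment-of j<m eq))))
      ... | inj₂ (eq , _) with row₁ (segment-of j<m eq)
      ...   | inj₁ (refl , _)                = inj₁ (sym (sucMod-segment right))
      ...   | inj₂ (inj₁ (_ , L≡B))          = ⊥-elim (1+n≢n (sym L≡B))
      ...   | inj₂ (inj₂ (inj₁ (_ , L≡1)))   = ⊥-elim (small≢L (s≤s (s≤s z≤n)) (sym L≡1))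
      ...   | inj₂ (inj₂ (inj₂ (_ , L≡0)))   = ⊥-elim (small≢L (s≤s z≤n) (sym L≡0))
      ladder-only-steps right j<m step with step-target step
      ... | inj₂ (_ , parity) = ⊥-elim (1+n≢0 (trans (sym L+1-odd) parity))
      ... | inj₁ eq with row₁ (segment-of j<m eq)
      ...   | inj₁ (_ , B≡L)                 = ⊥-elim (1+n≢n B≡L)
      ...   | inj₂ (inj₁ (refl , _))         = inj₁ (sym (sucMod-segment right-end))
      ...   | inj₂ (inj₂ (inj₁ (_ , B≡1)))   = ⊥-elim (small≢L (s≤s z≤n) (sym (suc-injective B≡1)))
      ...   | inj₂ (inj₂ (inj₂ (_ , ())))
      ladder-only-steps right-end j<m step with step-target step
      ... | inj₁ eq with row₁ (segment-of j<m eq)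
      ...   | inj₁ (_ , B+1≡L)               = ⊥-elim (<-irrefl (sym B+1≡L) (m<n⇒m<1+n (n<1+n L)))
      ...   | inj₂ (inj₁ (_ , B+1≡B))        = ⊥-elim (1+n≢n B+1≡B)
      ...   | inj₂ (inj₂ (inj₁ (_ , ())))
      ...   | inj₂ (inj₂ (inj₂ (_ , ())))
      ladder-only-steps right-end j<m step | inj₂ (eq , _) with row₂ (segment-of j<m eq)
      ... | s , s≤L , refl , B≡B∸s with ∸-cancelˡ-≡ (m≤n⇒m≤1+n s≤L) z≤n (sym B≡B∸s)
      ...   | refl = inj₁ (sym (sucMod-segment (bottom 0<L)))
      ladder-only-steps (bottom {s} s<L) j<m step with step-target step
      ... | inj₂ (eq , _) = ⊥-elim (row₃ (segment-of j<m eq))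
      ... | inj₁ eq with row₂ (segment-of j<m eq)
      ...   | s′ , s′≤L , refl , eq′ with bottom-pred (<⇒≤ s<L) s′≤L eq′
      ...     | refl = inj₂ (sym (sucMod-segment (bottom s<L)))
      ladder-only-steps bottom-end j<m step with step-target step
      ... | inj₂ (eq , _) = ⊥-elim (row₃ (segment-of j<m eq))
      ... | inj₁ eq with row₂ (segment-of j<m eq)
      ...   | s′ , s′≤L , refl , eq′ =
              inj₂ (trans (cong (λ z → 2 + z + B) (bottom-pred ≤-refl s′≤L (trans (cong suc (m+n∸n≡m 1 L)) eq′)))
                          (sym (sucMod-< (offset< (s≤s (s≤s (s≤s (m≤n⇒m≤1+n s′≤L))))))))
      ladder-only-steps left j<m step with step-target step
      ... | inj₁ eq with row₁ (segment-of j<m eq)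
      ...   | inj₁ (_ , 2≡L)                 = ⊥-elim (small≢L ≤-refl 2≡L)
      ...   | inj₂ (inj₁ (_ , 2≡B))          = ⊥-elim (small≢L (s≤s (s≤s z≤n)) (suc-injective 2≡B))
      ...   | inj₂ (inj₂ (inj₁ (_ , ())))
      ...   | inj₂ (inj₂ (inj₂ (_ , ())))
      ladder-only-steps left j<m step | inj₂ (eq , _) with row₂ (segment-of j<m eq)
      ... | s , s≤L , refl , 1≡B∸s with ∸-cancelˡ-≡ (m≤n⇒m≤1+n s≤L) (n≤1+n L) (trans (sym 1≡B∸s) (sym (m+n∸n≡m 1 L)))
      ...   | refl = inj₂ (sym (sucMod-segment left))
      ladder-only-steps left-end j<m step with step-target step
      ... | inj₂ (_ , ())
      ... | inj₁ eq with row₁ (segment-of j<m eq)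
      ...   | inj₁ (_ , 1≡L)                 = ⊥-elim (small≢L (s≤s (s≤s z≤n)) 1≡L)
      ...   | inj₂ (inj₁ (_ , 1≡B))          = ⊥-elim (small≢L (s≤s z≤n) (suc-injective 1≡B))
      ...   | inj₂ (inj₂ (inj₁ (refl , _)))  = inj₂ (sym (sucMod-segment left-end))
      ...   | inj₂ (inj₂ (inj₂ (_ , ())))

  segment-bounded : ∀ {i r c} → Segment i (r , c) → r ≤ 2 × c ≤ B
  segment-bounded (top t<L)  = z≤n , <⇒≤ (m<n⇒m<1+n t<L)
  segment-bounded top-end    = z≤n , n≤1+n L
  segment-bounded right      = s≤s z≤n , n≤1+n L
  segment-bounded right-end  = s≤s z≤n , ≤-refl
  segment-bounded (bottom {s} _) = ≤-refl , m∸n≤m B s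
  segment-bounded bottom-end = ≤-refl , s≤s z≤n
  segment-bounded left       = s≤s z≤n , s≤s z≤n
  segment-bounded left-end   = s≤s z≤n , z≤n

shift : ℕ → ℕ × ℕ → ℕ × ℕ
shift A (i , c) = (i , c + A)

shift-parity : ∀ {A} → A % 2 ≡ 0 → ∀ i c → (i + (c + A)) % 2 ≡ (i + c) % 2
shift-parity {A} A-even i c = begin
  (i + (c + A)) % 2            ≡⟨ cong (_% 2) (sym (+-assoc i c A)) ⟩
  (i + c + A) % 2              ≡⟨ %-distribˡ-+ (i + c) A 2 ⟩
  ((i + c) % 2 + A % 2) % 2    ≡⟨ cong (λ x → ((i + c) % 2 + x) % 2) A-even ⟩
  ((i + c) % 2 + 0) % 2        ≡⟨ cong (_% 2) (+-identityʳ ((i + c) % 2)) ⟩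
  (i + c) % 2 % 2              ≡⟨ m%n%n≡m%n (i + c) 2 ⟩
  (i + c) % 2                  ∎
  where open ≡-Reasoning

shift-step : ∀ {A p q} → A % 2 ≡ 0 → WallStep p q → WallStep (shift A p) (shift A q)
shift-step                 A-even (inj₁ (refl , refl))          = inj₁ (refl , refl)
shift-step {A} {i , c} A-even (inj₂ (refl , refl , parity)) =
  inj₂ (refl , refl , trans (shift-parity A-even i c) parity)

shift-step⁻¹ : ∀ {A p q} → A % 2 ≡ 0 → WallStep (shift A p) (shift A q) → WallStep p q
shift-step⁻¹ {A} {_ , c} {_ , c′} A-even (inj₁ (refl , c+A+1≡)) = inj₁ (refl , +-cancelʳ-≡ A (suc c) c′ c+A+1≡)
shift-step⁻¹ {A} {i , c} A-even (inj₂ (c+A≡ , refl , parity)) with +-cancelʳ-≡ A _ _ c+A≡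
... | refl = inj₂ (refl , refl , trans (sym (shift-parity A-even i c)) parity)

shift-injective : ∀ {A p q} → shift A p ≡ shift A q → p ≡ q
shift-injective {A} {i , c} {i′ , c′} eq = cong₂ _,_ (cong proj₁ eq) (+-cancelʳ-≡ A c c′ (cong proj₂ eq))

module WallGraph (r′ : ℕ) where

  r : ℕ
  r = suc r′

  Vertex : Set
  Vertex = Fin r × Fin (2 * r)

  wallRel? : ∀ x y → Dec (WallRel r x y)
  wallRel? (i , j) (i′ , j′) =
    ((i Fin.≟ i′) ×-dec (suc (toℕ j) ≟ toℕ j′)) ⊎-dec
    ((j Fin.≟ j′) ×-dec (suc (toℕ i) ≟ toℕ i′) ×-dec ((toℕ i + toℕ j) % 2 ≟ 0))

  wallRel-irrelevant : ∀ {x y} (p q : WallRel r x y) → p ≡ q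
  wallRel-irrelevant (inj₁ (a , b))     (inj₁ (a′ , b′))     = cong inj₁ (cong₂ _,_ (uip a a′) (uip b b′))
  wallRel-irrelevant (inj₂ (a , b , c)) (inj₂ (a′ , b′ , c′)) =
    cong inj₂ (cong₂ _,_ (uip a a′) (cong₂ _,_ (uip b b′) (uip c c′)))
  wallRel-irrelevant (inj₁ (_ , b))     (inj₂ (refl , _))    = ⊥-elim (1+n≢n b)
  wallRel-irrelevant (inj₂ (refl , _))  (inj₁ (_ , b))       = ⊥-elim (1+n≢n b)

  private
    no-2-cycle : ∀ {x y} → suc x ≡ y → suc y ≡ x → ⊥
    no-2-cycle {x} x+1≡y y+1≡x = <-irrefl (sym (trans (cong suc x+1≡y) y+1≡x)) (m<n⇒m<1+n (n<1+n x))

  wallRel-asym : ∀ {x y} → WallRel r x y → WallRel r y x → ⊥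
  wallRel-asym (inj₁ (_ , b))        (inj₁ (_ , b′))     = no-2-cycle b b′
  wallRel-asym (inj₁ (refl , _))     (inj₂ (_ , b , _))  = 1+n≢n b
  wallRel-asym (inj₂ (_ , b , _))    (inj₁ (refl , _))   = 1+n≢n b
  wallRel-asym (inj₂ (_ , b , _))    (inj₂ (_ , b′ , _)) = no-2-cycle b b′

  point : ℕ × ℕ → Vertex
  point (i , c) = (i mod r , c mod (2 * r))

  InWall : ℕ × ℕ → Set
  InWall (i , c) = i < r × c < 2 * r

  open EdgesOfRelation (WallRel r) wallRel? wallRel-irrelevant wallRel-asym
    ((point (0 , 0) , point (0 , 1)) , inj₁ (refl , sym (toℕ-mod {1} (s≤s (≤-trans (s≤s z≤n) (m≤n+m _ r′))))))
    public

  point-injective : ∀ {p q} → InWall p → InWall q → point p ≡ point q → p ≡ q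
  point-injective {i , c} {i′ , c′} (i<r , c<2r) (i′<r , c′<2r) eq =
    cong₂ _,_ (trans (sym (toℕ-mod i<r)) (trans (cong (toℕ ∘ proj₁) eq) (toℕ-mod i′<r)))
              (trans (sym (toℕ-mod c<2r)) (trans (cong (toℕ ∘ proj₂) eq) (toℕ-mod c′<2r)))

  point-step : ∀ {p q} → InWall p → InWall q → WallStep p q → WallRel r (point p) (point q)
  point-step {i , c} {_ , c′} (i<r , c<2r) (_ , c′<2r) (inj₁ (refl , c+1≡c′)) =
    inj₁ (refl , trans (cong suc (toℕ-mod c<2r)) (trans c+1≡c′ (sym (toℕ-mod c′<2r))))
  point-step {i , c} {i′ , _} (i<r , c<2r) (i′<r , _) (inj₂ (refl , i+1≡i′ , parity)) =
    inj₂ (refl , trans (cong suc (toℕ-mod i<r)) (trans i+1≡i′ (sym (toℕ-mod i′<r))) ,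
          trans (cong₂ (λ x y → (x + y) % 2) (toℕ-mod i<r) (toℕ-mod c<2r)) parity)

  step-point : ∀ {p q} → InWall p → InWall q → WallRel r (point p) (point q) → WallStep p q
  step-point {i , c} {i′ , c′} (i<r , c<2r) (i′<r , c′<2r) (inj₁ (i≡ , c+1≡)) =
    inj₁ (trans (sym (toℕ-mod i<r)) (trans (cong toℕ i≡) (toℕ-mod i′<r)) ,
          trans (cong suc (sym (toℕ-mod c<2r))) (trans c+1≡ (toℕ-mod c′<2r)))
  step-point {i , c} {i′ , c′} (i<r , c<2r) (i′<r , c′<2r) (inj₂ (c≡ , i+1≡ , parity)) =
    inj₂ (trans (sym (toℕ-mod c<2r)) (trans (cong toℕ c≡) (toℕ-mod c′<2r)) ,
          trans (cong suc (sym (toℕ-mod i<r))) (trans i+1≡ (toℕ-mod i′<r)) ,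
          trans (cong₂ (λ x y → (x + y) % 2) (sym (toℕ-mod i<r)) (sym (toℕ-mod c<2r))) parity)

  module _ (ℓ : EGraph.E (wall r) → ℕ) where

    horizontalWeight : ℕ → ℕ → ℕ
    horizontalWeight i c = suc (ℓ (edgeBetween (point (i , c)) (point (i , suc c))))

    verticalWeight : ℕ → ℕ → ℕ
    verticalWeight i c = suc (ℓ (edgeBetween (point (i , c)) (point (suc i , c))))

    rowsPotential : ℕ → ℕ
    rowsPotential = sumBelow (λ c → horizontalWeight 0 c + horizontalWeight 2 (suc c))

    sideWeight : ℕ → ℕ
    sideWeight c = verticalWeight 0 c + horizontalWeight 1 c + verticalWeight 1 (suc c)

  module WallLadder (A L : ℕ) where
    open Ladder L

    u : ℕ → Vertex
    u i = point (shift A (ladder i))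

    ladderLength : (EGraph.E (wall r) → ℕ) → ℕ
    ladderLength ℓ = sumBelow (λ i → suc (ℓ (edgeBetween (u i) (u (sucMod m i))))) m

    module _ (A-even : A % 2 ≡ 0) (L-even : L % 2 ≡ 0) (3≤L : 3 ≤ L) (3≤r : 3 ≤ r) (fits : B + A < 2 * r) where

      inWall : ∀ {i p} → Segment i p → InWall (shift A p)
      inWall {p = _ , c} σ with segment-bounded σ
      ... | row≤2 , c≤B = ≤-trans (s≤s row≤2) 3≤r , ≤-<-trans (+-monoˡ-≤ A c≤B) fits

      0<m : 0 < m
      0<m = s≤s z≤n

      steps : ∀ i → i < m → Adjacent (u i) (u (sucMod m i))
      steps i i<m with ladder-step 3≤L L-even (segment i<m)
      ... | inj₁ step = inj₁ (point-step in-i in-next (shift-step A-even step))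
        where in-i = inWall (segment i<m) ; in-next = inWall (segment (sucMod<M i 0<m))
      ... | inj₂ step = inj₂ (point-step in-next in-i (shift-step A-even step))
        where in-i = inWall (segment i<m) ; in-next = inWall (segment (sucMod<M i 0<m))

      u-injective : ∀ i j → i < m → j < m → u i ≡ u j → i ≡ j
      u-injective i j i<m j<m eq =
        segment-injective 3≤L (segment i<m)
          (segment-of j<m (sym (shift-injective (point-injective (inWall (segment i<m)) (inWall (segment j<m)) eq))))

      only-steps : ∀ i j → i < m → j < m → WallRel r (u i) (u j) → j ≡ sucMod m i ⊎ i ≡ sucMod m j
      only-steps i j i<m j<m adj =
        ladder-only-steps 3≤L L-even (segment i<m) j<m
          (shift-step⁻¹ A-even (step-point (inWall (segment i<m)) (inWall (segment j<m)) adj))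

      3≤m : 3 ≤ m
      3≤m = s≤s (s≤s (s≤s z≤n))

      cycle : Cycle (wall r) m
      cycle = relCycle u 3≤m steps u-injective

      chords : (ℓ : EGraph.E (wall r) → ℕ) → ChordsSubdivided ℓ cycle
      chords ℓ = relCycle-chordsSubdivided u 3≤m steps u-injective only-steps ℓ

      module _ (ℓ : EGraph.E (wall r) → ℕ) where

        subdivision-ladder : ∀ {n} (G : FinGraph n) →
          InducedIn (toGraph (subdivide (wall r) ℓ)) G → HasInducedCycle G (ladderLength ℓ)
        subdivision-ladder G = subdivision-inducedCycle ℓ cycle G (chords ℓ)

        lineGraph-ladder : ∀ {n} (G : FinGraph n) →
          InducedIn (lineGraph (subdivide (wall r) ℓ)) G → HasInducedCycle G (ladderLength ℓ)
        lineGraph-ladder G = lineGraph-inducedCycle ℓ cycle G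

        edgeWeight : ℕ × ℕ → ℕ × ℕ → ℕ
        edgeWeight p q = suc (ℓ (edgeBetween (point (shift A p)) (point (shift A q))))

        weight : ℕ → ℕ
        weight i = edgeWeight (ladder i) (ladder (sucMod m i))

        weight-forward : ∀ {i p q} → ladder i ≡ p → ladder (sucMod m i) ≡ q → weight i ≡ edgeWeight p q
        weight-forward = cong₂ edgeWeight

        weight-backward : ∀ {i p q} → i < m → ladder i ≡ p → ladder (sucMod m i) ≡ q → weight i ≡ edgeWeight q p
        weight-backward i<m refl refl = cong (λ e → suc (ℓ e)) (edgeBetween-comm (steps _ i<m))

        weight-top : ∀ {t} → t < L → weight t ≡ horizontalWeight ℓ 0 (t + A)
        weight-top {t} t<L = weight-forward {t} (ladder-at (top t<L))
          (trans (cong ladder (sucMod-< (≤-<-trans t<L (segment-index< top-end)))) (ladder-top (s≤s t<L)))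

        weight-top-end : weight L ≡ verticalWeight ℓ 0 (L + A)
        weight-top-end =
          weight-forward {L} (ladder-at top-end) (trans (cong ladder (sucMod-segment right)) (ladder-at right))

        weight-right : weight B ≡ horizontalWeight ℓ 1 (L + A)
        weight-right =
          weight-forward {B} (ladder-at right) (trans (cong ladder (sucMod-segment right-end)) (ladder-at right-end))

        weight-right-end : weight (suc B) ≡ verticalWeight ℓ 1 (B + A)
        weight-right-end = weight-forward {suc B} (ladder-at right-end)
          (trans (cong ladder (sucMod-segment (bottom 0<L))) (ladder-at (bottom 0<L)))
          where 0<L = ≤-trans (s≤s z≤n) 3≤L

        weight-bottom : ∀ {s} → s < L → weight (2 + s + B) ≡ horizontalWeight ℓ 2 (L ∸ s + A)
        weight-bottom {s} s<L = weight-backward {2 + s + B} (segment-index< (bottom s<L))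
          (trans (ladder-at (bottom s<L)) (cong (2 ,_) (+-∸-assoc 1 (<⇒≤ s<L))))
          (trans (cong ladder (sucMod-< (offset< (s≤s (s≤s (s≤s (≤-trans (<⇒≤ s<L) (n≤1+n L))))))))
                 (ladder-bottom (s≤s s<L)))

        weight-bottom-end : weight (2 + L + B) ≡ verticalWeight ℓ 1 (1 + A)
        weight-bottom-end = weight-backward {2 + L + B} (segment-index< bottom-end) (ladder-at bottom-end)
          (trans (cong ladder (sucMod-segment left)) (ladder-at left))

        weight-left : weight (2 + B + B) ≡ horizontalWeight ℓ 1 A
        weight-left = weight-backward {2 + B + B} (segment-index< left) (ladder-at left)
          (trans (cong ladder (sucMod-segment left-end)) (ladder-at left-end))

        weight-left-end : weight (3 + B + B) ≡ verticalWeight ℓ 0 A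
        weight-left-end = weight-backward {3 + B + B} (segment-index< left-end) (ladder-at left-end)
          (trans (cong ladder (sucMod-≡ {m} {3 + B + B} refl)) (ladder-top (s≤s z≤n)))

        ladderLength-potential :
          ladderLength ℓ + rowsPotential ℓ A ≡ rowsPotential ℓ (L + A) + sideWeight ℓ A + sideWeight ℓ (L + A)
        ladderLength-potential = begin
          ladderLength ℓ + S A
            ≡⟨ cong (_+ S A) (ladder-sum weight (sumBelow-cong L (λ _ → weight-top)) weight-top-end weight-right
                                                weight-right-end bottom-row weight-bottom-end weight-left weight-left-end) ⟩
          T + v 0 (L + A) + (h 1 (L + A) + (v 1 (B + A) + (T′ + v 1 (1 + A)))) + h 1 A + v 0 A + S A
            ≡⟨ rearrange T (v 0 (L + A)) (h 1 (L + A)) (v 1 (B + A)) T′ (v 1 (1 + A)) (h 1 A) (v 0 A) (S A) ⟩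
          S A + (T + T′) + sideWeight ℓ A + sideWeight ℓ (L + A)
            ≡⟨ cong (λ x → x + sideWeight ℓ A + sideWeight ℓ (L + A)) (sym rows-split) ⟩
          S (L + A) + sideWeight ℓ A + sideWeight ℓ (L + A) ∎
          where
          open ≡-Reasoning
          h = horizontalWeight ℓ
          v = verticalWeight ℓ
          S = rowsPotential ℓ
          T = sumBelow (λ t → h 0 (t + A)) L
          T′ = sumBelow (λ t → h 2 (suc t + A)) L

          bottom-row : sumBelow (λ s → weight (2 + s + B)) L ≡ T′
          bottom-row = begin
            sumBelow (λ s → weight (2 + s + B)) L        ≡⟨ sumBelow-cong L (λ _ → weight-bottom) ⟩
            sumBelow (λ s → h 2 (L ∸ s + A)) L            ≡⟨ sumBelow-cong L (λ s s<L → cong (λ x → h 2 (x + A))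
                                                                                              (+-∸-assoc 1 s<L)) ⟩
            sumBelow (λ s → h 2 (suc (L ∸ suc s) + A)) L  ≡⟨ sumBelow-reverse (λ t → h 2 (suc t + A)) L ⟩
            T′                                           ∎

          rows-split : S (L + A) ≡ S A + (T + T′)
          rows-split = trans (sumBelow-split _ L A) (cong (S A +_) (sumBelow-+ _ _ L))

          rearrange : ∀ t a b c t′ d e g s →
            t + a + (b + (c + (t′ + d))) + e + g + s ≡ s + (t + t′) + (g + e + d) + (a + b + c)
          rearrange = solve-∀

-- f = 2N + 2 leaves room for the ladders on columns 4a … 4b + 1 of W_f and for the vertices
-- 0 … N + 1 of K_f.
module Construction (c : ℕ) where

  N : ℕ
  N = 2 + c * c

  f : ℕ
  f = 2 + (N + N)

  3≤f : 3 ≤ f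
  3≤f = s≤s (s≤s (s≤s z≤n))

  ×4-even : ∀ x → (x * 4) % 2 ≡ 0
  ×4-even x = subst (λ y → y % 2 ≡ 0) (*-assoc x 2 2) (m*n%n≡0 (x * 2) 2)

  span×4 : ∀ {a b} → a < b → (b ∸ a) * 4 + a * 4 ≡ b * 4
  span×4 {a} {b} a<b = trans (sym (*-distribʳ-+ 4 (b ∸ a) a)) (cong (_* 4) (m∸n+n≡m (<⇒≤ a<b)))

  span×4≥3 : ∀ {a b} → a < b → 3 ≤ (b ∸ a) * 4
  span×4≥3 a<b = ≤-trans (n≤1+n 3) (*-monoˡ-≤ 4 (m<n⇒0<n∸m a<b))

  ladder-fits : ∀ {a b} → a < b → b ≤ N → suc ((b ∸ a) * 4) + a * 4 < 2 * f
  ladder-fits {a} {b} a<b b≤N = begin-strict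
    suc ((b ∸ a) * 4 + a * 4) ≡⟨ cong suc (span×4 a<b) ⟩
    suc (b * 4)               <⟨ s≤s (s≤s (*-monoˡ-≤ 4 b≤N)) ⟩
    2 + N * 4                 ≤⟨ m≤n+m _ 2 ⟩
    2 + (2 + N * 4)           ≡⟨ double N ⟩
    2 * f                     ∎
    where
    open ≤-Reasoning
    double : ∀ n → 2 + (2 + n * 4) ≡ 2 * (2 + (n + n))
    double = solve-∀

  hub-fits : ∀ {a b} → a < b → b ≤ N → suc (b ∸ a + a) < f
  hub-fits {a} {b} a<b b≤N rewrite m∸n+n≡m (<⇒≤ a<b) = s≤s (s≤s (≤-trans b≤N (m≤m+n N N)))

  module _ {n} (G : FinGraph n) where
    open WallGraph (suc (N + N))

    wall-clAtLeast : (ℓ : EGraph.E (wall f) → ℕ) →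
      (∀ A L → A % 2 ≡ 0 → L % 2 ≡ 0 → 3 ≤ L → suc L + A < 2 * f →
         HasInducedCycle G (WallLadder.ladderLength A L ℓ)) →
      ClAtLeast G (suc c)
    wall-clAtLeast ℓ ladders = distinct-from-potential {HasInducedCycle G} c
      (λ a b → WallLadder.ladderLength (a * 4) ((b ∸ a) * 4) ℓ)
      (λ x → rowsPotential ℓ (x * 4)) (λ x → sideWeight ℓ (x * 4))
      (λ x y _ _ eq → *-cancelʳ-≡ x y 4 (sumBelow-injective (λ _ → s≤s z≤n) eq))
      (λ a b a<b b≤N → trans
        (WallLadder.ladderLength-potential (a * 4) ((b ∸ a) * 4) (×4-even a) (×4-even (b ∸ a)) (span×4≥3 a<b) 3≤f
           (ladder-fits a<b b≤N) ℓ)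
        (cong (λ x → rowsPotential ℓ x + sideWeight ℓ (a * 4) + sideWeight ℓ x) (span×4 a<b)))
      (λ a b a<b b≤N →
         ladders (a * 4) ((b ∸ a) * 4) (×4-even a) (×4-even (b ∸ a)) (span×4≥3 a<b) (ladder-fits a<b b≤N))

    complete-clAtLeast : (ℓ : EGraph.E (complete f) → ℕ) → Proper (complete f) ℓ →
      InducedIn (toGraph (subdivide (complete f) ℓ)) G → ClAtLeast G (suc c)
    complete-clAtLeast ℓ proper H↪G = distinct-from-potential {HasInducedCycle G} c
      (λ a b → HubCycle.cycleLength a (b ∸ a) ℓ) (pathLength ℓ) (hubWeight ℓ)
      (λ x y _ _ eq → sumBelow-injective (λ _ → s≤s z≤n) eq)
      (λ a b a<b b≤N → trans (HubCycle.cycleLength-potential a (b ∸ a) (m<n⇒0<n∸m a<b) (hub-fits a<b b≤N) ℓ)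
                             (cong (λ x → pathLength ℓ x + hubWeight ℓ a + hubWeight ℓ x) (m∸n+n≡m (<⇒≤ a<b))))
      (λ a b a<b b≤N → HubCycle.cycleLength-induced a (b ∸ a) (m<n⇒0<n∸m a<b) (hub-fits a<b b≤N) ℓ G proper H↪G)
      where open CompleteGraph (N + N)

lemma3p3 : (c : ℕ) → 1 ≤ c →
    Σ[ f ∈ ℕ ] (1 ≤ f ×
      ((n : ℕ) (G : FinGraph n) →
        ((Σ[ ℓ ∈ (EGraph.E (wall f) → ℕ) ] InducedIn (toGraph (subdivide (wall f) ℓ)) G)
         ⊎ (Σ[ ℓ ∈ (EGraph.E (wall f) → ℕ) ] InducedIn (lineGraph (subdivide (wall f) ℓ)) G)
         ⊎ (Σ[ ℓ ∈ (EGraph.E (complete f) → ℕ) ]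
              (Proper (complete f) ℓ × InducedIn (toGraph (subdivide (complete f) ℓ)) G))) →
        ClAtLeast G c))
lemma3p3 (suc c) _ = f , s≤s z≤n , cl≥
  where
  open Construction c
  open WallGraph (suc (N + N)) using (module WallLadder)

  cl≥ : (n : ℕ) (G : FinGraph n) → _ → ClAtLeast G (suc c)
  cl≥ n G (inj₁ (ℓ , H↪G)) = wall-clAtLeast G ℓ λ A L A-even L-even 3≤L fits →
    WallLadder.subdivision-ladder A L A-even L-even 3≤L 3≤f fits ℓ G H↪G
  cl≥ n G (inj₂ (inj₁ (ℓ , L↪G))) = wall-clAtLeast G ℓ λ A L A-even L-even 3≤L fits →
    WallLadder.lineGraph-ladder A L A-even L-even 3≤L 3≤f fits ℓ G L↪G
  cl≥ n G (inj₂ (inj₂ (ℓ , proper , H↪G))) = complete-clAtLeast G ℓ proper H↪G
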